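{- Let $n\ge 2$ and $t\ge 0$ be integers, and let $\pi^{(t)}$ be the product of $t$ reflections chosen independently and uniformly at random from the set $T$ of reflections of the group $D_n$. Then: (a) The expected length of $\pi^{(t)}$ is \[ E^{D_n}_{T,\ell}(t)=\frac{n(n-1)}{2}-\frac{n(2n-1)}{6}\left(1-\frac2n\right)^t-\frac{n(n-2)}{6}\left(1-\frac4n\right)^t. \] (b) If $i,j\in[-n,n]\setminus\{0\}$ and $j>|i|$, the probability that $\pi^{(t)}_i>\pi^{(t)}_j$ is \[ \frac12-\frac{j-i-1+\operatorname{sgn} i}{2(n-1)}\left(1-\frac2n\right)^t+\left(\frac{j-i-1+\operatorname{sgn} i}{2(n-1)}-\frac12\right)\left(1-\frac4n\right)^t. \]
   Context: $D_n$ is realized as the group of permutations $\pi$ of $[-n,n]\setminus\{0\}$ (integers between $-n$ and $n$, excluding $0$) such that $\pi_{ -i}=-\pi_i$ for all $i$ and the number of $i\in\{1,\dots,n\}$ with $\pi_i<0$ is even. Its set of reflections is $T=\{(i,j)(-i,-j): 1\le|i|<j\le n\}$ in cycle notation (so $|T|=n^2-n$). The (Coxeter) length $\ell(\pi)$ equals the number of D-inversions: pairs $(i,j)$ with $i,j\in[-n,n]\setminus\{0\}$, $j>|i|$ and $\pi_i>\pi_j$. $E^{D_n}_{T,\ell}(t):=|T|^{ -t}\sum_{r_1,\dots,r_t\in T}\ell(r_1\cdots r_t)$. $\operatorname{sgn} i$ is $1$ if $i>0$ and $-1$ if $i<0$. -}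

module Defs where

open import Data.Nat as ℕ using (ℕ; zero; suc)
open import Data.Integer as ℤ using (ℤ; +_; -[1+_]; -_; ∣_∣)
open import Data.Rational as ℚ using (ℚ)
open import Data.List using (List; []; _∷_; map; upTo; _++_; concatMap; filter; length)
open import Data.Nat.ListAction using (sum)
open import Data.Bool using (if_then_else_)
open import Data.Product using (_×_; _,_; proj₁; proj₂)
open import Relation.Nullary.Decidable using (⌊_⌋)
open import Function using (id; _∘_)

pos : ℕ → List ℤ
pos n = map (λ k → + suc k) (upTo n)

dom : ℕ → List ℤ
dom n = map -_ (pos n) ++ pos n

pairs : ℕ → List (ℤ × ℤ)
pairs n = concatMap (λ j → map (λ i → i , j) (filter (λ i → + ∣ i ∣ ℤ.<? j) (dom n))) (pos n)

-- a signed permutation is represented by its action on ℤ (only values on [-n,n]\{0} matter)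
-- the reflection (i,j)(-i,-j)
reflection : ℤ → ℤ → ℤ → ℤ
reflection i j x =
  if ⌊ x ℤ.≟ i ⌋ then j else
  if ⌊ x ℤ.≟ j ⌋ then i else
  if ⌊ x ℤ.≟ - i ⌋ then - j else
  if ⌊ x ℤ.≟ - j ⌋ then - i else x

T : ℕ → List (ℤ → ℤ)
T n = map (λ p → reflection (proj₁ p) (proj₂ p)) (pairs n)

products : ℕ → ℕ → List (ℤ → ℤ)
products n zero = id ∷ []
products n (suc t) = concatMap (λ r → map (λ π → r ∘ π) (products n t)) (T n)

-- Coxeter length = number of D-inversions
len : ℕ → (ℤ → ℤ) → ℕ
len n π = length (filter (λ p → π (proj₂ p) ℤ.<? π (proj₁ p)) (pairs n))

-- a / d in ℚ (convention a / 0 = 0; only used with d ≠ 0)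
frac : ℤ → ℕ → ℚ
frac a zero = ℚ.0ℚ
frac a (suc d) = a ℚ./ suc d

infixr 8 _^ℚ_
_^ℚ_ : ℚ → ℕ → ℚ
q ^ℚ zero = ℚ.1ℚ
q ^ℚ suc t = q ℚ.* (q ^ℚ t)

E : ℕ → ℕ → ℚ
E n t = frac (+ sum (map (len n) (products n t))) (length (T n) ℕ.^ t)

Prob : ℕ → ℕ → ℤ → ℤ → ℚ
Prob n t i j = frac (+ length (filter (λ π → π j ℤ.<? π i) (products n t))) (length (T n) ℕ.^ t)

sgn : ℤ → ℤ
sgn (+ _) = + 1
sgn -[1+ _ ] = ℤ.-1ℤ

-- Fix positions x, y and let N_t(x, y) count the products π = r₁ ⋯ r_t with π y < π x.
-- Splitting off the rightmost factor gives N_{t+1}(x, y) = Σ_{r ∈ T} N_t(r x, r y), so N_t is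
-- obtained by iterating the operator g ↦ Σ_{r ∈ T} g ∘ r on functions of the pair (x, y).
-- With φ x = x − sgn x, this operator preserves the span of 1, φ x − φ y and [y < x]:
--   Σ_r 1 = n(n−1),   Σ_r φ(r x) = (n−1)(n−2) φ x,
--   Σ_r [r y < r x] = (n−1)(n−4) [y < x] + 2(n−1) + (φ x − φ y),
-- the last two by induction on n, adding the reflections (∓(k+1), n+1) that involve n + 1.
-- Hence 2(n−1) N_t is an explicit combination of μ₀^t, μ₁^t, μ₂^t with μ₀ = n(n−1),
-- μ₁ = (n−1)(n−2), μ₂ = (n−1)(n−4). Divided by |T|^t = μ₀^t this is part (b); summing it over
-- all D-inversion pairs (i, j), where [j < i] = 0, Σ φ i = 0 and 3 Σ φ j = (n−1) n (2n−1), gives (a).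

module Submission where

open import Defs
open import Data.Nat as ℕ using (ℕ; zero; suc; _∸_)
open import Data.Integer as ℤ using (ℤ; +_; -[1+_]; ∣_∣; _+_; _*_; _-_; -_; _^_)
open import Data.List using (List; []; _∷_; map; _++_; concatMap; filter; length; applyUpTo; upTo)
open import Data.Nat.ListAction using (sum)
open import Data.Bool using (Bool; true; false; if_then_else_)
open import Relation.Nullary using (Dec; does; yes; no; ¬_)
open import Relation.Binary.Definitions using (tri<; tri≈; tri>)
open import Relation.Unary using (Decidable)
open import Relation.Binary.PropositionalEquality
open import Relation.Nullary.Decidable using (⌊_⌋; dec-true; dec-false)
open import Data.Product using (_×_; _,_; proj₁; proj₂)
open import Data.Empty using (⊥-elim)
open import Data.Sum using (_⊎_; inj₁; inj₂)
open import Function using (_∘_; id)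
import Data.Nat.Properties as ℕP
import Data.Integer.Properties as ℤP
open import Data.Integer.GCD using (gcd)
open import Data.Rational as ℚ using (ℚ; ↥_; ↧_)
open import Data.Rational.Unnormalised as ℚᵘ using (mkℚᵘ; *≡*)
import Data.Rational.Unnormalised.Properties as ℚᵘP
import Data.Rational.Properties as ℚP
open import Data.Integer.Tactic.RingSolver
open import Algebra.Properties.CommutativeSemigroup ℤP.+-commutativeSemigroup using () renaming (interchange to +-interchange)

∑ : {A : Set} → (A → ℤ) → List A → ℤ
∑ f [] = + 0
∑ f (x ∷ xs) = f x + ∑ f xs

∑-++ : ∀ {A : Set} (f : A → ℤ) xs ys → ∑ f (xs ++ ys) ≡ ∑ f xs + ∑ f ys
∑-++ f [] ys = sym (ℤP.+-identityˡ _)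
∑-++ f (x ∷ xs) ys = trans (cong (_+_ (f x)) (∑-++ f xs ys)) (sym (ℤP.+-assoc (f x) _ _))

∑-map : ∀ {A B : Set} (f : B → ℤ) (g : A → B) xs → ∑ f (map g xs) ≡ ∑ (f ∘ g) xs
∑-map f g [] = refl
∑-map f g (x ∷ xs) = cong (_+_ (f (g x))) (∑-map f g xs)

∑-concatMap : ∀ {A B : Set} (f : B → ℤ) (g : A → List B) xs →
  ∑ f (concatMap g xs) ≡ ∑ (λ x → ∑ f (g x)) xs
∑-concatMap f g [] = refl
∑-concatMap f g (x ∷ xs) =
  trans (∑-++ f (g x) (concatMap g xs)) (cong (_+_ (∑ f (g x))) (∑-concatMap f g xs))

∑-cong : ∀ {A : Set} {f g : A → ℤ} → (∀ x → f x ≡ g x) → ∀ xs → ∑ f xs ≡ ∑ g xs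
∑-cong f≗g [] = refl
∑-cong f≗g (x ∷ xs) = cong₂ _+_ (f≗g x) (∑-cong f≗g xs)

∑-zero : ∀ {A : Set} (xs : List A) → ∑ (λ _ → + 0) xs ≡ + 0
∑-zero [] = refl
∑-zero (x ∷ xs) = trans (ℤP.+-identityˡ _) (∑-zero xs)

∑-+ : ∀ {A : Set} (f g : A → ℤ) xs → ∑ (λ x → f x + g x) xs ≡ ∑ f xs + ∑ g xs
∑-+ f g [] = refl
∑-+ f g (x ∷ xs) rewrite ∑-+ f g xs = +-interchange (f x) (g x) (∑ f xs) (∑ g xs)

∑-swap : ∀ {A B : Set} (f : A → B → ℤ) xs ys →
  ∑ (λ x → ∑ (f x) ys) xs ≡ ∑ (λ y → ∑ (λ x → f x y) xs) ys
∑-swap f [] ys = sym (∑-zero ys)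
∑-swap f (x ∷ xs) ys =
  trans (cong (_+_ (∑ (f x) ys)) (∑-swap f xs ys)) (sym (∑-+ (f x) (λ y → ∑ (λ x′ → f x′ y) xs) ys))

∑-filter : ∀ {A : Set} {P : A → Set} (P? : Decidable P) (f : A → ℤ) xs →
  ∑ f (filter P? xs) ≡ ∑ (λ x → if does (P? x) then f x else + 0) xs
∑-filter P? f [] = refl
∑-filter P? f (x ∷ xs) with does (P? x)
... | true = cong (_+_ (f x)) (∑-filter P? f xs)
... | false = trans (∑-filter P? f xs) (sym (ℤP.+-identityˡ _))

𝟙 : ∀ {P : Set} → Dec P → ℤ
𝟙 P? = if does P? then + 1 else + 0

length-filter : ∀ {A : Set} {P : A → Set} (P? : Decidable P) xs →
  + length (filter P? xs) ≡ ∑ (𝟙 ∘ P?) xs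
length-filter P? [] = refl
length-filter P? (x ∷ xs) with does (P? x)
... | true = trans (ℤP.pos-+ 1 _) (cong (_+_ (+ 1)) (length-filter P? xs))
... | false = trans (length-filter P? xs) (sym (ℤP.+-identityˡ _))

length≡∑1 : ∀ {A : Set} (xs : List A) → + length xs ≡ ∑ (λ _ → + 1) xs
length≡∑1 [] = refl
length≡∑1 (x ∷ xs) = trans (ℤP.pos-+ 1 (length xs)) (cong (_+_ (+ 1)) (length≡∑1 xs))

∑< : ℕ → (ℕ → ℤ) → ℤ
∑< zero f = + 0
∑< (suc n) f = ∑< n f + f n

∑<-sucˡ : ∀ n (f : ℕ → ℤ) → ∑< (suc n) f ≡ f 0 + ∑< n (f ∘ suc)
∑<-sucˡ zero f = trans (ℤP.+-identityˡ (f 0)) (sym (ℤP.+-identityʳ (f 0)))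
∑<-sucˡ (suc n) f = trans (cong (_+ f (suc n)) (∑<-sucˡ n f)) (ℤP.+-assoc (f 0) _ _)

∑-applyUpTo : ∀ (f : ℕ → ℤ) (h : ℕ → ℕ) n → ∑ f (applyUpTo h n) ≡ ∑< n (f ∘ h)
∑-applyUpTo f h zero = refl
∑-applyUpTo f h (suc n) =
  trans (cong (_+_ (f (h 0))) (∑-applyUpTo f (h ∘ suc) n)) (sym (∑<-sucˡ n (f ∘ h)))

∑<-cong : ∀ n {f g : ℕ → ℤ} → (∀ k → k ℕ.< n → f k ≡ g k) → ∑< n f ≡ ∑< n g
∑<-cong zero f≗g = refl
∑<-cong (suc n) f≗g =
  cong₂ _+_ (∑<-cong n (λ k k<n → f≗g k (ℕP.m<n⇒m<1+n k<n))) (f≗g n ℕP.≤-refl)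

∑<-+ : ∀ n (f g : ℕ → ℤ) → ∑< n (λ k → f k + g k) ≡ ∑< n f + ∑< n g
∑<-+ zero f g = refl
∑<-+ (suc n) f g rewrite ∑<-+ n f g = +-interchange (∑< n f) (∑< n g) (f n) (g n)

∑<-* : ∀ n c (f : ℕ → ℤ) → ∑< n (λ k → c * f k) ≡ c * ∑< n f
∑<-* zero c f = sym (ℤP.*-zeroʳ c)
∑<-* (suc n) c f rewrite ∑<-* n c f = sym (ℤP.*-distribˡ-+ c (∑< n f) (f n))

∑<-const : ∀ n c → ∑< n (λ _ → c) ≡ + n * c
∑<-const zero c = sym (ℤP.*-zeroˡ c)
∑<-const (suc n) c rewrite ∑<-const n c = lemma (+ n) c
  where
  lemma : ∀ a c → a * c + c ≡ (+ 1 + a) * c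
  lemma = solve-∀

∑<-truncate : ∀ n m {f g : ℕ → ℤ} → m ℕ.≤ n → (∀ k → k ℕ.< m → f k ≡ g k) →
  (∀ k → m ℕ.≤ k → k ℕ.< n → f k ≡ + 0) → ∑< n f ≡ ∑< m g
∑<-truncate zero .zero ℕ.z≤n f≗g f≗0 = refl
∑<-truncate (suc n) m m≤1+n f≗g f≗0 with ℕP.m≤n⇒m<n∨m≡n m≤1+n
... | inj₁ m<1+n =
  trans (cong₂ _+_ (∑<-truncate n m (ℕP.≤-pred m<1+n) f≗g (λ k m≤k k<n → f≗0 k m≤k (ℕP.m<n⇒m<1+n k<n)))
                   (f≗0 n (ℕP.≤-pred m<1+n) ℕP.≤-refl))
        (ℤP.+-identityʳ _)
... | inj₂ refl = ∑<-cong (suc n) f≗g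

∑<-split : ∀ n m {f : ℕ → ℤ} c d → m ℕ.≤ n → (∀ k → k ℕ.< m → f k ≡ c) →
  (∀ k → m ℕ.≤ k → k ℕ.< n → f k ≡ d) → ∑< n f ≡ + m * c + (+ n - + m) * d
∑<-split zero .zero c d ℕ.z≤n _ _ = lemma c d
  where
  lemma : ∀ c d → + 0 ≡ + 0 * c + (+ 0 - + 0) * d
  lemma = solve-∀
∑<-split (suc n) m {f} c d m≤1+n below above with ℕP.m≤n⇒m<n∨m≡n m≤1+n
... | inj₁ m<1+n
  rewrite ∑<-split n m c d (ℕP.≤-pred m<1+n) below (λ k m≤k k<n → above k m≤k (ℕP.m<n⇒m<1+n k<n))
        | above n (ℕP.≤-pred m<1+n) ℕP.≤-refl = lemma (+ m) (+ n) c d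
  where
  lemma : ∀ m x c d → m * c + (x - m) * d + d ≡ m * c + (+ 1 + x - m) * d
  lemma = solve-∀
... | inj₂ refl rewrite ∑<-cong (suc n) {f} {λ _ → c} below | ∑<-const (suc n) c = lemma (+ suc n) c d
  where
  lemma : ∀ x c d → x * c ≡ x * c + (x - x) * d
  lemma = solve-∀

∑<-except : ∀ n p {f : ℕ → ℤ} c → p ℕ.< n → (∀ k → k ℕ.< n → k ≢ p → f k ≡ c) →
  ∑< n f ≡ + n * c + (f p - c)
∑<-except zero p c () _
∑<-except (suc n) p {f} c p<1+n f≗c with p ℕP.≟ n
... | yes refl
  rewrite ∑<-cong p {f} {λ _ → c} (λ k k<p → f≗c k (ℕP.m<n⇒m<1+n k<p) (ℕP.<⇒≢ k<p))
        | ∑<-const p c = lemma (+ p) c (f p)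
  where
  lemma : ∀ x c a → x * c + a ≡ (+ 1 + x) * c + (a - c)
  lemma = solve-∀
... | no p≢n
  rewrite ∑<-except n p c (ℕP.≤∧≢⇒< (ℕP.≤-pred p<1+n) p≢n) (λ k k<n → f≗c k (ℕP.m<n⇒m<1+n k<n))
        | f≗c n ℕP.≤-refl (p≢n ∘ sym) = lemma (+ n) c (f p)
  where
  lemma : ∀ x c a → x * c + (a - c) + c ≡ (+ 1 + x) * c + (a - c)
  lemma = solve-∀

∑<-except₂ : ∀ n p q {f : ℕ → ℤ} c → p ℕ.< n → q ℕ.< n → p ≢ q →
  (∀ k → k ℕ.< n → k ≢ p → k ≢ q → f k ≡ c) → ∑< n f ≡ + n * c + (f p - c) + (f q - c)
∑<-except₂ zero p q c () _ _ _
∑<-except₂ (suc n) p q {f} c p<1+n q<1+n p≢q f≗c with p ℕP.≟ n | q ℕP.≟ n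
... | yes refl | yes refl = ⊥-elim (p≢q refl)
... | yes refl | no q≢p
  rewrite ∑<-except p q c (ℕP.≤∧≢⇒< (ℕP.≤-pred q<1+n) q≢p)
            (λ k k<p k≢q → f≗c k (ℕP.m<n⇒m<1+n k<p) (ℕP.<⇒≢ k<p) k≢q) =
    lemma (+ p) c (f p) (f q)
  where
  lemma : ∀ x c a b → x * c + (b - c) + a ≡ (+ 1 + x) * c + (a - c) + (b - c)
  lemma = solve-∀
... | no p≢q′ | yes refl
  rewrite ∑<-except q p c (ℕP.≤∧≢⇒< (ℕP.≤-pred p<1+n) p≢q′)
            (λ k k<q k≢p → f≗c k (ℕP.m<n⇒m<1+n k<q) k≢p (ℕP.<⇒≢ k<q)) =
    lemma (+ q) c (f p) (f q)
  where
  lemma : ∀ x c a b → x * c + (a - c) + b ≡ (+ 1 + x) * c + (a - c) + (b - c)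
  lemma = solve-∀
... | no p≢n | no q≢n
  rewrite ∑<-except₂ n p q c (ℕP.≤∧≢⇒< (ℕP.≤-pred p<1+n) p≢n) (ℕP.≤∧≢⇒< (ℕP.≤-pred q<1+n) q≢n)
            p≢q
            (λ k k<n → f≗c k (ℕP.m<n⇒m<1+n k<n))
        | f≗c n ℕP.≤-refl (p≢n ∘ sym) (q≢n ∘ sym) = lemma (+ n) c (f p) (f q)
  where
  lemma : ∀ x c a b → x * c + (a - c) + (b - c) + c ≡ (+ 1 + x) * c + (a - c) + (b - c)
  lemma = solve-∀

-- Sums over the index pairs of D-inversions and over T

μ₀ μ₁ μ₂ : ℕ → ℤ
μ₀ n = + n * (+ n - + 1)
μ₁ n = (+ n - + 1) * (+ n - + 2)
μ₂ n = (+ n - + 1) * (+ n - + 4)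

-- The pair (i , j) with 1 ≤ |i| < j ≤ n is written (∓(k+1) , l+1) with k < l < n; ∑pairs sums
-- column by column, so ∑pairs (1 + n) adds exactly the pairs with j = n + 1.
pairSum : (ℤ → ℤ → ℤ) → ℕ → ℕ → ℤ
pairSum G k j = G -[1+ k ] (+ suc j) + G (+ suc k) (+ suc j)

∑pairs : ℕ → (ℤ → ℤ → ℤ) → ℤ
∑pairs n G = ∑< n λ j → ∑< j λ k → pairSum G k j

∑-pairs : ∀ n (G : ℤ → ℤ → ℤ) → ∑ (λ p → G (proj₁ p) (proj₂ p)) (pairs n) ≡ ∑pairs n G
∑-pairs n G =
  trans (∑-concatMap (λ p → G (proj₁ p) (proj₂ p)) _ (pos n))
  (trans (∑-cong (λ j → ∑-map (λ p → G (proj₁ p) (proj₂ p)) (λ i → i , j) (filter (λ i → + ∣ i ∣ ℤ.<? j) (dom n)))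
                 (pos n))
  (trans (∑-map _ (λ j → + suc j) (upTo n))
  (trans (∑-applyUpTo _ id n)
         (∑<-cong n column))))
  where
  column : ∀ j → j ℕ.< n → ∑ (λ i → G i (+ suc j)) (filter (λ i → + ∣ i ∣ ℤ.<? + suc j) (dom n))
                          ≡ ∑< j (λ k → pairSum G k j)
  column j j<n =
    trans (∑-filter (λ i → + ∣ i ∣ ℤ.<? + suc j) (λ i → G i (+ suc j)) (dom n))
    (trans (∑-++ F (map -_ (pos n)) (pos n))
    (trans (cong₂ _+_ (trans (∑-map F -_ (pos n))
                             (trans (∑-map (F ∘ -_) (λ k → + suc k) (upTo n)) (∑-applyUpTo _ id n)))
                      (trans (∑-map F (λ k → + suc k) (upTo n)) (∑-applyUpTo _ id n)))
    (trans (cong₂ _+_ (∑<-truncate n j (ℕP.<⇒≤ j<n) (λ k k<j → cong (keep (G -[1+ k ] (+ suc j))) (below k<j))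
                                                    (λ k j≤k _ → cong (keep (G -[1+ k ] (+ suc j))) (above j≤k)))
                      (∑<-truncate n j (ℕP.<⇒≤ j<n) (λ k k<j → cong (keep (G (+ suc k) (+ suc j))) (below k<j))
                                                    (λ k j≤k _ → cong (keep (G (+ suc k) (+ suc j))) (above j≤k))))
           (sym (∑<-+ j _ _)))))
    where
    F : ℤ → ℤ
    F i = if does (+ ∣ i ∣ ℤ.<? + suc j) then G i (+ suc j) else + 0
    keep : ℤ → Bool → ℤ
    keep a b = if b then a else + 0
    below : ∀ {k} → k ℕ.< j → does (+ suc k ℤ.<? + suc j) ≡ true
    below k<j = dec-true (_ ℤ.<? _) (ℤ.+<+ (ℕ.s≤s k<j))
    above : ∀ {k} → j ℕ.≤ k → does (+ suc k ℤ.<? + suc j) ≡ false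
    above j≤k = dec-false (_ ℤ.<? _) (λ lt → ℕP.<⇒≱ (ℕP.≤-pred (ℤP.drop‿+<+ lt)) j≤k)

∑pairs-cong : ∀ n {G H : ℤ → ℤ → ℤ} →
  (∀ k j → k ℕ.< j → j ℕ.< n → pairSum G k j ≡ pairSum H k j) →
  ∑pairs n G ≡ ∑pairs n H
∑pairs-cong n G≗H = ∑<-cong n (λ j j<n → ∑<-cong j (λ k k<j → G≗H k j k<j j<n))

∑pairs-const : ∀ n c → ∑pairs n (λ _ _ → c) ≡ μ₀ n * c
∑pairs-const zero c = refl
∑pairs-const (suc n) c rewrite ∑pairs-const n c | ∑<-const n (c + c) = lemma (+ n) c
  where
  lemma : ∀ x c → x * (x - + 1) * c + x * (c + c) ≡ (+ 1 + x) * (+ 1 + x - + 1) * c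
  lemma = solve-∀

∑pairs-+ : ∀ n (F G : ℤ → ℤ → ℤ) → ∑pairs n (λ i j → F i j + G i j) ≡ ∑pairs n F + ∑pairs n G
∑pairs-+ n F G =
  trans (∑<-cong n (λ j _ → trans (∑<-cong j (λ k _ → interchange k j)) (∑<-+ j _ _))) (∑<-+ n _ _)
  where
  interchange : ∀ k j → pairSum (λ i j → F i j + G i j) k j ≡ pairSum F k j + pairSum G k j
  interchange k j = +-interchange (F -[1+ k ] (+ suc j)) (G -[1+ k ] (+ suc j)) (F (+ suc k) (+ suc j)) (G (+ suc k) (+ suc j))

∑pairs-* : ∀ n c (F : ℤ → ℤ → ℤ) → ∑pairs n (λ i j → c * F i j) ≡ c * ∑pairs n F
∑pairs-* n c F =
  trans (∑<-cong n (λ j _ → trans (∑<-cong j (λ k _ → sym (ℤP.*-distribˡ-+ c _ _))) (∑<-* j c _))) (∑<-* n c _)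

∑pairs-affine : ∀ n c₀ c₁ c₂ c₃ (F G H : ℤ → ℤ → ℤ) →
  ∑pairs n (λ i j → c₀ + c₁ * F i j + c₂ * G i j + c₃ * H i j)
    ≡ μ₀ n * c₀ + c₁ * ∑pairs n F + c₂ * ∑pairs n G + c₃ * ∑pairs n H
∑pairs-affine n c₀ c₁ c₂ c₃ F G H
  rewrite ∑pairs-+ n (λ i j → c₀ + c₁ * F i j + c₂ * G i j) (λ i j → c₃ * H i j)
        | ∑pairs-+ n (λ i j → c₀ + c₁ * F i j) (λ i j → c₂ * G i j)
        | ∑pairs-+ n (λ _ _ → c₀) (λ i j → c₁ * F i j)
        | ∑pairs-* n c₁ F | ∑pairs-* n c₂ G | ∑pairs-* n c₃ H | ∑pairs-const n c₀ = refl

∑T : ℕ → ((ℤ → ℤ) → ℤ) → ℤ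
∑T n g = ∑pairs n (λ i j → g (reflection i j))

∑-T : ∀ n g → ∑ g (T n) ≡ ∑T n g
∑-T n g = trans (∑-map g _ (pairs n)) (∑-pairs n (λ i j → g (reflection i j)))

-- products n (1 + t) adds its new factor on the left; regroup by the rightmost factor instead.
∑-products-suc : ∀ n t (Q : (ℤ → ℤ) → ℤ) →
  ∑ Q (products n (suc t)) ≡ ∑ (λ r → ∑ (λ π → Q (π ∘ r)) (products n t)) (T n)
∑-products-suc n zero Q = ∑-concatMap Q _ (T n)
∑-products-suc n (suc t) Q =
  trans (∑-concatMap Q _ (T n))
  (trans (∑-cong (λ r₁ → trans (∑-map Q (r₁ ∘_) (products n (suc t))) (∑-products-suc n t (Q ∘ (r₁ ∘_))))
                 (T n))
  (trans (∑-swap (λ r₁ r → ∑ (λ π → Q (r₁ ∘ π ∘ r)) (products n t)) (T n) (T n))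
         (∑-cong (λ r → sym (trans (∑-concatMap (λ π → Q (π ∘ r)) _ (T n))
                                   (∑-cong (λ r₁ → ∑-map (λ π → Q (π ∘ r)) (r₁ ∘_) (products n t)) (T n))))
                 (T n))))

inversions : ℕ → ℕ → ℤ → ℤ → ℤ
inversions n t x y = ∑ (λ π → 𝟙 (π y ℤ.<? π x)) (products n t)

inversions-suc : ∀ n t x y → inversions n (suc t) x y ≡ ∑T n (λ r → inversions n t (r x) (r y))
inversions-suc n t x y = trans (∑-products-suc n t (λ π → 𝟙 (π y ℤ.<? π x))) (∑-T n _)

∣i∣≡∣j∣⇒i≡j⊎i≡-j : ∀ {i j} → ∣ i ∣ ≡ ∣ j ∣ → i ≡ j ⊎ i ≡ - j
∣i∣≡∣j∣⇒i≡j⊎i≡-j {+ m} {+ n} e = inj₁ (cong +_ e)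
∣i∣≡∣j∣⇒i≡j⊎i≡-j {+ m} { -[1+ n ]} refl = inj₂ refl
∣i∣≡∣j∣⇒i≡j⊎i≡-j { -[1+ m ]} {+ n} refl = inj₂ refl
∣i∣≡∣j∣⇒i≡j⊎i≡-j { -[1+ m ]} { -[1+ n ]} refl = inj₁ refl

transpose : ℕ → ℕ → ℕ → ℕ
transpose a b m = if ⌊ m ℕ.≟ a ⌋ then b else if ⌊ m ℕ.≟ b ⌋ then a else m

transpose-a : ∀ a b → transpose a b a ≡ b
transpose-a a b with a ℕ.≟ a
... | yes _ = refl
... | no a≢a = ⊥-elim (a≢a refl)

transpose-b : ∀ a b → transpose a b b ≡ a
transpose-b a b with b ℕ.≟ a
... | yes b≡a = b≡a
... | no _ with b ℕ.≟ b
...   | yes _ = refl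
...   | no b≢b = ⊥-elim (b≢b refl)

transpose-other : ∀ {a b m} → m ≢ a → m ≢ b → transpose a b m ≡ m
transpose-other {a} {b} {m} m≢a m≢b with m ℕ.≟ a
... | yes m≡a = ⊥-elim (m≢a m≡a)
... | no _ with m ℕ.≟ b
...   | yes m≡b = ⊥-elim (m≢b m≡b)
...   | no _ = refl

transpose-involutive : ∀ a b m → transpose a b (transpose a b m) ≡ m
transpose-involutive a b m = by-cases (m ℕ.≟ a) (m ℕ.≟ b)
  where
  by-cases : Dec (m ≡ a) → Dec (m ≡ b) → transpose a b (transpose a b m) ≡ m
  by-cases (yes refl) _ = trans (cong (transpose m b) (transpose-a m b)) (transpose-b m b)
  by-cases (no _) (yes refl) = trans (cong (transpose a m) (transpose-b a m)) (transpose-a a m)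
  by-cases (no m≢a) (no m≢b) =
    trans (cong (transpose a b) (transpose-other m≢a m≢b)) (transpose-other m≢a m≢b)

transpose-injective : ∀ a b {m m′} → transpose a b m ≡ transpose a b m′ → m ≡ m′
transpose-injective a b {m} {m′} e =
  trans (sym (transpose-involutive a b m)) (trans (cong (transpose a b) e) (transpose-involutive a b m′))

reflection-i : ∀ i j → reflection i j i ≡ j
reflection-i i j with i ℤ.≟ i
... | yes _ = refl
... | no i≢i = ⊥-elim (i≢i refl)

reflection-j : ∀ i j → j ≢ i → reflection i j j ≡ i
reflection-j i j j≢i with j ℤ.≟ i
... | yes j≡i = ⊥-elim (j≢i j≡i)
... | no _ with j ℤ.≟ j
...   | yes _ = refl
...   | no j≢j = ⊥-elim (j≢j refl)

reflection-−i : ∀ i j → - i ≢ i → - i ≢ j → reflection i j (- i) ≡ - j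
reflection-−i i j ≢i ≢j with - i ℤ.≟ i
... | yes e = ⊥-elim (≢i e)
... | no _ with - i ℤ.≟ j
...   | yes e = ⊥-elim (≢j e)
...   | no _ with - i ℤ.≟ - i
...     | yes _ = refl
...     | no ≢-i = ⊥-elim (≢-i refl)

reflection-−j : ∀ i j → - j ≢ i → - j ≢ j → - j ≢ - i → reflection i j (- j) ≡ - i
reflection-−j i j ≢i ≢j ≢-i with - j ℤ.≟ i
... | yes e = ⊥-elim (≢i e)
... | no _ with - j ℤ.≟ j
...   | yes e = ⊥-elim (≢j e)
...   | no _ with - j ℤ.≟ - i
...     | yes e = ⊥-elim (≢-i e)
...     | no _ with - j ℤ.≟ - j
...       | yes _ = refl
...       | no ≢-j = ⊥-elim (≢-j refl)

reflection-fixed : ∀ i j x → ∣ x ∣ ≢ ∣ i ∣ → ∣ x ∣ ≢ ∣ j ∣ → reflection i j x ≡ x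
reflection-fixed i j x ≢i ≢j with x ℤ.≟ i
... | yes refl = ⊥-elim (≢i refl)
... | no _ with x ℤ.≟ j
...   | yes refl = ⊥-elim (≢j refl)
...   | no _ with x ℤ.≟ - i
...     | yes refl = ⊥-elim (≢i (ℤP.∣-i∣≡∣i∣ i))
...     | no _ with x ℤ.≟ - j
...       | yes refl = ⊥-elim (≢j (ℤP.∣-i∣≡∣i∣ j))
...       | no _ = refl

∣reflection∣ : ∀ i j x → ∣ reflection i j x ∣ ≡ transpose (∣ i ∣) (∣ j ∣) (∣ x ∣)
∣reflection∣ i j x with x ℤ.≟ i
... | yes refl = sym (transpose-a (∣ x ∣) (∣ j ∣))
... | no x≢i with x ℤ.≟ j
...   | yes refl = sym (transpose-b (∣ i ∣) (∣ x ∣))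
...   | no x≢j with x ℤ.≟ - i
...     | yes refl rewrite ℤP.∣-i∣≡∣i∣ i | ℤP.∣-i∣≡∣i∣ j = sym (transpose-a (∣ i ∣) (∣ j ∣))
...     | no x≢-i with x ℤ.≟ - j
...       | yes refl rewrite ℤP.∣-i∣≡∣i∣ i | ℤP.∣-i∣≡∣i∣ j = sym (transpose-b (∣ i ∣) (∣ j ∣))
...       | no x≢-j = sym (transpose-other (neither x≢i x≢-i) (neither x≢j x≢-j))
  where
  neither : ∀ {z} → x ≢ z → x ≢ - z → ∣ x ∣ ≢ ∣ z ∣
  neither x≢z x≢-z e with ∣i∣≡∣j∣⇒i≡j⊎i≡-j e
  ... | inj₁ x≡z = x≢z x≡z
  ... | inj₂ x≡-z = x≢-z x≡-z

transpose-preserves : ∀ (P : ℕ → Set) {a b m} → P a → P b → P m → P (transpose a b m)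
transpose-preserves P {a} {b} {m} Pa Pb Pm with m ℕ.≟ a
... | yes _ = Pb
... | no _ with m ℕ.≟ b
...   | yes _ = Pa
...   | no _ = Pm

InRange : ℕ → ℕ → Set
InRange n m = 1 ℕ.≤ m × m ℕ.≤ n

inRange-suc : ∀ {n m} → m ℕ.< n → InRange n (suc m)
inRange-suc m<n = ℕ.s≤s ℕ.z≤n , m<n

inRange-∣∣ : ∀ {n m} x → ∣ x ∣ ≡ suc m → m ℕ.< n → InRange n ∣ x ∣
inRange-∣∣ x ∣x∣≡1+m m<n = subst (InRange _) (sym ∣x∣≡1+m) (inRange-suc m<n)

Admissible : ℕ → ℤ → ℤ → Set
Admissible n x y = InRange n ∣ x ∣ × InRange n ∣ y ∣ × ∣ x ∣ ≢ ∣ y ∣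

∣reflection∣-≢ : ∀ i j {x y} → ∣ x ∣ ≢ ∣ y ∣ → ∣ reflection i j x ∣ ≢ ∣ reflection i j y ∣
∣reflection∣-≢ i j {x} {y} ∣x∣≢∣y∣ e =
  ∣x∣≢∣y∣ (transpose-injective (∣ i ∣) (∣ j ∣)
    (trans (sym (∣reflection∣ i j x)) (trans e (∣reflection∣ i j y))))

admissible-reflection : ∀ n i j {x y} → InRange n ∣ i ∣ → InRange n ∣ j ∣ →
  Admissible n x y → Admissible n (reflection i j x) (reflection i j y)
admissible-reflection n i j {x} {y} i∈ j∈ (x∈ , y∈ , ∣x∣≢∣y∣) =
  subst (InRange n) (sym (∣reflection∣ i j x)) (transpose-preserves (InRange n) i∈ j∈ x∈) ,
  subst (InRange n) (sym (∣reflection∣ i j y)) (transpose-preserves (InRange n) i∈ j∈ y∈) ,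
  ∣reflection∣-≢ i j {x} {y} ∣x∣≢∣y∣

r⁺ r⁻ : ℕ → ℕ → ℤ → ℤ
r⁺ k j = reflection (+ suc k) (+ suc j)
r⁻ k j = reflection -[1+ k ] (+ suc j)

FixedBy MovedBy : ℕ → ℕ → ℕ → Set
FixedBy k j m = m ≢ suc k × m ≢ suc j
MovedBy k j m = m ≡ suc k ⊎ m ≡ suc j

fixedBy-≢ : ∀ {k j p m} → m ≡ suc p → p ≢ k → p ≢ j → FixedBy k j m
fixedBy-≢ {p = p} m≡1+p p≢k p≢j = ≢-suc p≢k , ≢-suc p≢j
  where
  ≢-suc : ∀ {a} → p ≢ a → _ ≢ suc a
  ≢-suc p≢a m≡1+a = p≢a (ℕP.suc-injective (trans (sym m≡1+p) m≡1+a))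

fixedBy-> : ∀ {k j m} → k ℕ.< j → suc j ℕ.< m → FixedBy k j m
fixedBy-> k<j 1+j<m = ℕP.>⇒≢ (ℕP.<-trans (ℕ.s≤s k<j) 1+j<m) , ℕP.>⇒≢ 1+j<m

r±-fixed : ∀ {k j} x → FixedBy k j ∣ x ∣ → r⁺ k j x ≡ x × r⁻ k j x ≡ x
r±-fixed {k} {j} x (≢k , ≢j) =
  reflection-fixed (+ suc k) (+ suc j) x ≢k ≢j , reflection-fixed -[1+ k ] (+ suc j) x ≢k ≢j

r⁻≡-r⁺ : ∀ {k j} x → k ≢ j → MovedBy k j ∣ x ∣ → r⁻ k j x ≡ - r⁺ k j x
r⁻≡-r⁺ {k} {j} x k≢j (inj₁ ∣x∣≡1+k) with ∣i∣≡∣j∣⇒i≡j⊎i≡-j {x} {+ suc k} ∣x∣≡1+k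
... | inj₁ refl = trans (reflection-−i -[1+ k ] (+ suc j) (λ ()) (k≢j ∘ ℕP.suc-injective ∘ ℤP.+-injective))
                        (cong -_ (sym (reflection-i (+ suc k) (+ suc j))))
... | inj₂ refl = trans (reflection-i -[1+ k ] (+ suc j)) (cong -_ (sym (reflection-−i (+ suc k) (+ suc j) (λ ()) (λ ()))))
r⁻≡-r⁺ {k} {j} x k≢j (inj₂ ∣x∣≡1+j) with ∣i∣≡∣j∣⇒i≡j⊎i≡-j {x} {+ suc j} ∣x∣≡1+j
... | inj₁ refl = trans (reflection-j -[1+ k ] (+ suc j) (λ ()))
                        (cong -_ (sym (reflection-j (+ suc k) (+ suc j) (k≢j ∘ sym ∘ ℕP.suc-injective ∘ ℤP.+-injective))))
... | inj₂ refl = trans (reflection-−j -[1+ k ] (+ suc j) -j≢-k (λ ()) (λ ()))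
                        (cong -_ (sym (reflection-−j (+ suc k) (+ suc j) (λ ()) (λ ()) -j≢-k)))
  where
  -j≢-k : -[1+ j ] ≢ -[1+ k ]
  -j≢-k e = k≢j (sym (ℤP.-[1+-injective e))

∣r⁺∣-k : ∀ {k j} x → ∣ x ∣ ≡ suc k → ∣ r⁺ k j x ∣ ≡ suc j
∣r⁺∣-k {k} {j} x ∣x∣≡1+k =
  trans (∣reflection∣ (+ suc k) (+ suc j) x)
        (trans (cong (transpose (suc k) (suc j)) ∣x∣≡1+k) (transpose-a (suc k) (suc j)))

∣r⁺∣-j : ∀ {k j} x → ∣ x ∣ ≡ suc j → ∣ r⁺ k j x ∣ ≡ suc k
∣r⁺∣-j {k} {j} x ∣x∣≡1+j =
  trans (∣reflection∣ (+ suc k) (+ suc j) x)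
        (trans (cong (transpose (suc k) (suc j)) ∣x∣≡1+j) (transpose-b (suc k) (suc j)))

r±-sum : ((ℤ → ℤ) → ℤ) → ℕ → ℕ → ℤ
r±-sum g = pairSum (λ i j → g (reflection i j))

module _ (G : ℤ → ℤ → ℤ) {k j : ℕ} (x y : ℤ) where

  r±-sum-fixed : FixedBy k j ∣ x ∣ → FixedBy k j ∣ y ∣ → r±-sum (λ r → G (r x) (r y)) k j ≡ G x y + G x y
  r±-sum-fixed fx fy =
    cong₂ _+_ (cong₂ G (proj₂ (r±-fixed x fx)) (proj₂ (r±-fixed y fy)))
              (cong₂ G (proj₁ (r±-fixed x fx)) (proj₁ (r±-fixed y fy)))

  r±-sum-movedˡ : k ≢ j → MovedBy k j ∣ x ∣ → FixedBy k j ∣ y ∣ →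
    r±-sum (λ r → G (r x) (r y)) k j ≡ G (- r⁺ k j x) y + G (r⁺ k j x) y
  r±-sum-movedˡ k≢j mx fy =
    cong₂ _+_ (cong₂ G (r⁻≡-r⁺ x k≢j mx) (proj₂ (r±-fixed y fy)))
              (cong (G (r⁺ k j x)) (proj₁ (r±-fixed y fy)))

  r±-sum-movedʳ : k ≢ j → FixedBy k j ∣ x ∣ → MovedBy k j ∣ y ∣ →
    r±-sum (λ r → G (r x) (r y)) k j ≡ G x (- r⁺ k j y) + G x (r⁺ k j y)
  r±-sum-movedʳ k≢j fx my =
    cong₂ _+_ (cong₂ G (proj₂ (r±-fixed x fx)) (r⁻≡-r⁺ y k≢j my))
              (cong (λ u → G u (r⁺ k j y)) (proj₁ (r±-fixed x fx)))

  r±-sum-moved² : k ≢ j → MovedBy k j ∣ x ∣ → MovedBy k j ∣ y ∣ →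
    r±-sum (λ r → G (r x) (r y)) k j ≡ G (- r⁺ k j x) (- r⁺ k j y) + G (r⁺ k j x) (r⁺ k j y)
  r±-sum-moved² k≢j mx my =
    cong (_+ G (r⁺ k j x) (r⁺ k j y)) (cong₂ G (r⁻≡-r⁺ x k≢j mx) (r⁻≡-r⁺ y k≢j my))

∑T-constant : ∀ n (g : (ℤ → ℤ) → ℤ) c → (∀ k j → k ℕ.< j → j ℕ.< n → r±-sum g k j ≡ c + c) →
  ∑T n g ≡ μ₀ n * c
∑T-constant n g c g≗c = trans (∑pairs-cong n {λ i j → g (reflection i j)} {λ _ _ → c} g≗c) (∑pairs-const n c)

-- Averaging φ and the inversion indicator over T

φ : ℤ → ℤ
φ (+ zero) = + 0
φ (+ suc m) = + m
φ -[1+ m ] = - (+ m)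

φ-neg : ∀ w → φ (- w) ≡ - φ w
φ-neg (+ zero) = refl
φ-neg (+ suc m) = refl
φ-neg -[1+ m ] = sym (ℤP.neg-involutive (+ m))

φ-odd : ∀ w → φ (- w) + φ w ≡ + 0
φ-odd w rewrite φ-neg w = ℤP.+-inverseˡ (φ w)

∑T-φ : ∀ n x → InRange n ∣ x ∣ → ∑T n (λ r → φ (r x)) ≡ μ₁ n * φ x
∑T-φ zero x (1≤∣x∣ , ∣x∣≤0) = ⊥-elim (ℕP.<-irrefl refl (ℕP.≤-trans 1≤∣x∣ ∣x∣≤0))
∑T-φ (suc n) x x∈ with ∣ x ∣ in ∣x∣≡ | x∈
... | zero | () , _
... | suc p | _ , p<1+n with ℕP.m≤n⇒m<n∨m≡n (ℕP.≤-pred p<1+n)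
...   | inj₁ p<n =
  trans (cong₂ _+_ (∑T-φ n x (inRange-∣∣ x ∣x∣≡ p<n))
                   (trans (∑<-except n p (φ x + φ x) p<n unmoved)
                          (cong (λ z → + n * (φ x + φ x) + (z - (φ x + φ x))) moved)))
        (lemma (+ n) (φ x))
  where
  unmoved : ∀ k → k ℕ.< n → k ≢ p → r±-sum (λ r → φ (r x)) k n ≡ φ x + φ x
  unmoved k k<n k≢p = r±-sum-fixed (λ u _ → φ u) x x f f
    where
    f : FixedBy k n ∣ x ∣
    f = fixedBy-≢ ∣x∣≡ (k≢p ∘ sym) (ℕP.<⇒≢ p<n)
  moved : r±-sum (λ r → φ (r x)) p n ≡ + 0
  moved = trans (r±-sum-moved² (λ u _ → φ u) x x (ℕP.<⇒≢ p<n) (inj₁ ∣x∣≡) (inj₁ ∣x∣≡))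
                (φ-odd (r⁺ p n x))
  lemma : ∀ x f → (x - + 1) * (x - + 2) * f + (x * (f + f) + (+ 0 - (f + f))) ≡ (+ 1 + x - + 1) * (+ 1 + x - + 2) * f
  lemma = solve-∀
...   | inj₂ refl =
  trans (cong₂ _+_ (∑T-constant p (λ r → φ (r x)) (φ x) unmoved) (trans (∑<-cong p moved) (∑<-const p (+ 0))))
        (lemma (+ p) (φ x))
  where
  unmoved : ∀ k j → k ℕ.< j → j ℕ.< p → r±-sum (λ r → φ (r x)) k j ≡ φ x + φ x
  unmoved k j k<j j<p = r±-sum-fixed (λ u _ → φ u) x x f f
    where
    f : FixedBy k j ∣ x ∣
    f = fixedBy-≢ ∣x∣≡ (ℕP.>⇒≢ (ℕP.<-trans k<j j<p)) (ℕP.>⇒≢ j<p)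
  moved : ∀ k → k ℕ.< p → r±-sum (λ r → φ (r x)) k p ≡ + 0
  moved k k<p = trans (r±-sum-moved² (λ u _ → φ u) x x (ℕP.<⇒≢ k<p) (inj₂ ∣x∣≡) (inj₂ ∣x∣≡))
                      (φ-odd (r⁺ k p x))
  lemma : ∀ x f → x * (x - + 1) * f + x * + 0 ≡ (+ 1 + x - + 1) * (+ 1 + x - + 2) * f
  lemma = solve-∀

inverted : ℤ → ℤ → ℤ
inverted u v = 𝟙 (v ℤ.<? u)

inverted-yes : ∀ {u v} → v ℤ.< u → inverted u v ≡ + 1
inverted-yes {u} {v} v<u = cong (if_then + 1 else + 0) (dec-true (v ℤ.<? u) v<u)

inverted-no : ∀ {u v} → ¬ v ℤ.< u → inverted u v ≡ + 0
inverted-no {u} {v} v≮u = cong (if_then + 1 else + 0) (dec-false (v ℤ.<? u) v≮u)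

inverted-flip : ∀ {u v} → u ≢ v → inverted v u ≡ + 1 - inverted u v
inverted-flip {u} {v} u≢v with ℤP.<-cmp u v
... | tri< u<v _ _ rewrite inverted-yes u<v | inverted-no (ℤP.<-asym u<v) = refl
... | tri≈ _ u≡v _ = ⊥-elim (u≢v u≡v)
... | tri> _ _ v<u rewrite inverted-no (ℤP.<-asym v<u) | inverted-yes v<u = refl

inverted-±ˡ-< : ∀ w y → ∣ y ∣ ℕ.< ∣ w ∣ → inverted (- w) y + inverted w y ≡ + 1
inverted-±ˡ-< = by-sign
  where
  positive : ∀ a y → ∣ y ∣ ℕ.< suc a → inverted -[1+ a ] y + inverted (+ suc a) y ≡ + 1
  positive a (+ m) m<1+a
    rewrite inverted-no { -[1+ a ]} {+ m} (λ ()) | inverted-yes {+ suc a} {+ m} (ℤ.+<+ m<1+a) = refl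
  positive a -[1+ m ] m<a
    rewrite inverted-no { -[1+ a ]} { -[1+ m ]} (λ { (ℤ.-<- a<m) → ℕP.<-asym a<m (ℕP.≤-pred m<a) })
          | inverted-yes {+ suc a} { -[1+ m ]} ℤ.-<+ = refl
  by-sign : ∀ w y → ∣ y ∣ ℕ.< ∣ w ∣ → inverted (- w) y + inverted w y ≡ + 1
  by-sign (+ zero) y ()
  by-sign (+ suc a) y = positive a y
  by-sign -[1+ a ] y ∣y∣<∣w∣ =
    trans (ℤP.+-comm (inverted (+ suc a) y) (inverted -[1+ a ] y)) (positive a y ∣y∣<∣w∣)

inverted-±ˡ-> : ∀ w y → ∣ w ∣ ℕ.< ∣ y ∣ → inverted (- w) y + inverted w y ≡ + 1 - sgn y
inverted-±ˡ-> = by-sign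
  where
  positive : ∀ a y → suc a ℕ.< ∣ y ∣ → inverted -[1+ a ] y + inverted (+ suc a) y ≡ + 1 - sgn y
  positive a (+ m) 1+a<m
    rewrite inverted-no { -[1+ a ]} {+ m} (λ ())
          | inverted-no {+ suc a} {+ m} (λ { (ℤ.+<+ m<1+a) → ℕP.<-asym m<1+a 1+a<m }) = refl
  positive a -[1+ m ] a<m
    rewrite inverted-yes { -[1+ a ]} { -[1+ m ]} (ℤ.-<- (ℕP.≤-pred a<m)) | inverted-yes {+ suc a} { -[1+ m ]} ℤ.-<+ = refl
  by-sign : ∀ w y → ∣ w ∣ ℕ.< ∣ y ∣ → inverted (- w) y + inverted w y ≡ + 1 - sgn y
  by-sign (+ zero) (+ zero) ()
  by-sign (+ zero) (+ suc m) _ rewrite inverted-no {+ 0} {+ suc m} (λ { (ℤ.+<+ ()) }) = refl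
  by-sign (+ zero) -[1+ m ] _ rewrite inverted-yes {+ 0} { -[1+ m ]} ℤ.-<+ = refl
  by-sign (+ suc a) y = positive a y
  by-sign -[1+ a ] y ∣w∣<∣y∣ =
    trans (ℤP.+-comm (inverted (+ suc a) y) (inverted -[1+ a ] y)) (positive a y ∣w∣<∣y∣)

inverted-±ʳ-< : ∀ x v → ∣ x ∣ ℕ.< ∣ v ∣ → inverted x (- v) + inverted x v ≡ + 1
inverted-±ʳ-< = by-sign
  where
  positive : ∀ a x → ∣ x ∣ ℕ.< suc a → inverted x -[1+ a ] + inverted x (+ suc a) ≡ + 1
  positive a (+ m) m<1+a
    rewrite inverted-yes {+ m} { -[1+ a ]} ℤ.-<+
          | inverted-no {+ m} {+ suc a} (λ { (ℤ.+<+ 1+a<m) → ℕP.<-asym m<1+a 1+a<m }) = refl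
  positive a -[1+ m ] m<a
    rewrite inverted-yes { -[1+ m ]} { -[1+ a ]} (ℤ.-<- (ℕP.≤-pred m<a)) | inverted-no { -[1+ m ]} {+ suc a} (λ ()) = refl
  by-sign : ∀ x v → ∣ x ∣ ℕ.< ∣ v ∣ → inverted x (- v) + inverted x v ≡ + 1
  by-sign x (+ zero) ()
  by-sign x (+ suc a) = positive a x
  by-sign x -[1+ a ] ∣x∣<∣v∣ =
    trans (ℤP.+-comm (inverted x (+ suc a)) (inverted x -[1+ a ])) (positive a x ∣x∣<∣v∣)

inverted-±ʳ-> : ∀ x v → ∣ v ∣ ℕ.< ∣ x ∣ → inverted x (- v) + inverted x v ≡ + 1 + sgn x
inverted-±ʳ-> = by-sign
  where
  positive : ∀ a x → suc a ℕ.< ∣ x ∣ → inverted x -[1+ a ] + inverted x (+ suc a) ≡ + 1 + sgn x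
  positive a (+ m) 1+a<m
    rewrite inverted-yes {+ m} { -[1+ a ]} ℤ.-<+ | inverted-yes {+ m} {+ suc a} (ℤ.+<+ 1+a<m) = refl
  positive a -[1+ m ] a<m
    rewrite inverted-no { -[1+ m ]} { -[1+ a ]} (λ { (ℤ.-<- m<a) → ℕP.<-asym m<a (ℕP.≤-pred a<m) })
          | inverted-no { -[1+ m ]} {+ suc a} (λ ()) = refl
  by-sign : ∀ x v → ∣ v ∣ ℕ.< ∣ x ∣ → inverted x (- v) + inverted x v ≡ + 1 + sgn x
  by-sign (+ zero) (+ zero) ()
  by-sign (+ suc m) (+ zero) _ rewrite inverted-yes {+ suc m} {+ 0} (ℤ.+<+ (ℕ.s≤s ℕ.z≤n)) = refl
  by-sign -[1+ m ] (+ zero) _ rewrite inverted-no { -[1+ m ]} {+ 0} (λ ()) = refl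
  by-sign x (+ suc a) = positive a x
  by-sign x -[1+ a ] ∣v∣<∣x∣ =
    trans (ℤP.+-comm (inverted x (+ suc a)) (inverted x -[1+ a ])) (positive a x ∣v∣<∣x∣)

inverted-±² : ∀ w v → w ≢ v → inverted (- w) (- v) + inverted w v ≡ + 1
inverted-±² w v w≢v with ℤP.<-cmp w v
... | tri< w<v _ _ rewrite inverted-yes (ℤP.neg-mono-< w<v) | inverted-no (ℤP.<-asym w<v) = refl
... | tri≈ _ w≡v _ = ⊥-elim (w≢v w≡v)
... | tri> _ _ v<w rewrite inverted-no { - w} { - v} (ℤP.<-asym v<w ∘ ℤP.neg-cancel-<) | inverted-yes v<w = refl

sgn≡2*inverted-1 : ∀ x y → ∣ y ∣ ℕ.< ∣ x ∣ → sgn x ≡ + 2 * inverted x y - + 1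
sgn≡2*inverted-1 (+ m) (+ a) a<m rewrite inverted-yes (ℤ.+<+ a<m) = refl
sgn≡2*inverted-1 (+ m) -[1+ a ] _ rewrite inverted-yes { + m} { -[1+ a ]} ℤ.-<+ = refl
sgn≡2*inverted-1 -[1+ m ] (+ a) _ rewrite inverted-no { -[1+ m ]} {+ a} (λ ()) = refl
sgn≡2*inverted-1 -[1+ m ] -[1+ a ] a<m
  rewrite inverted-no { -[1+ m ]} { -[1+ a ]} (λ { (ℤ.-<- m<a) → ℕP.<-asym m<a (ℕP.≤-pred a<m) }) = refl

φ≡sgn*pred∣∣ : ∀ x p → ∣ x ∣ ≡ suc p → φ x ≡ sgn x * + p
φ≡sgn*pred∣∣ x p ∣x∣≡1+p with ∣i∣≡∣j∣⇒i≡j⊎i≡-j {x} {+ suc p} ∣x∣≡1+p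
... | inj₁ refl = sym (ℤP.*-identityˡ (+ p))
... | inj₂ refl = sym (ℤP.-1*i≡-i (+ p))

∑T-inverted-flip : ∀ n x y → ∣ x ∣ ≢ ∣ y ∣ →
  ∑T n (λ r → inverted (r y) (r x)) ≡ μ₀ n - ∑T n (λ r → inverted (r x) (r y))
∑T-inverted-flip n x y ∣x∣≢∣y∣ =
  trans (∑pairs-cong n {λ i j → inverted (reflection i j y) (reflection i j x)}
                       {λ i j → + 1 + - + 1 * inverted (reflection i j x) (reflection i j y)}
                     (λ k j _ _ → cong₂ _+_ (flip -[1+ k ] (+ suc j)) (flip (+ suc k) (+ suc j))))
  (trans (∑pairs-+ n (λ _ _ → + 1) (λ i j → - + 1 * inverted (reflection i j x) (reflection i j y)))
  (trans (cong₂ _+_ (∑pairs-const n (+ 1)) (∑pairs-* n (- + 1) (λ i j → inverted (reflection i j x) (reflection i j y))))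
         (lemma (+ n) (∑T n (λ r → inverted (r x) (r y))))))
  where
  flip : ∀ i j → inverted (reflection i j y) (reflection i j x) ≡ + 1 + - + 1 * inverted (reflection i j x) (reflection i j y)
  flip i j = trans (inverted-flip {reflection i j x} {reflection i j y}
                                   (∣reflection∣-≢ i j {x} {y} ∣x∣≢∣y∣ ∘ cong ∣_∣))
                   (cong (_+_ (+ 1)) (sym (ℤP.-1*i≡-i (inverted (reflection i j x) (reflection i j y)))))
  lemma : ∀ x S → x * (x - + 1) * + 1 + - + 1 * S ≡ x * (x - + 1) - S
  lemma = solve-∀

∑T-inverted-outside : ∀ n x y → n ℕ.< ∣ x ∣ → InRange n ∣ y ∣ →
  ∑T n (λ r → inverted (r x) (r y)) ≡ μ₁ n * inverted x y + (+ n - + 1) * (+ 1 + sgn x)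
∑T-inverted-outside zero x y _ (1≤∣y∣ , ∣y∣≤0) = ⊥-elim (ℕP.<-irrefl refl (ℕP.≤-trans 1≤∣y∣ ∣y∣≤0))
∑T-inverted-outside (suc n) x y n<∣x∣ y∈ with ∣ y ∣ in ∣y∣≡ | y∈
... | zero | () , _
... | suc q | _ , q<1+n with ℕP.m≤n⇒m<n∨m≡n (ℕP.≤-pred q<1+n)
...   | inj₁ q<n =
  trans (cong₂ _+_ (∑T-inverted-outside n x y (ℕP.<-trans (ℕP.n<1+n n) n<∣x∣) (inRange-∣∣ y ∣y∣≡ q<n))
                   (trans (∑<-except n q (I + I) q<n unmoved) (cong (λ z → + n * (I + I) + (z - (I + I))) moved)))
        (lemma (+ n) I (sgn x))
  where
  I : ℤ
  I = inverted x y
  unmoved : ∀ k → k ℕ.< n → k ≢ q → r±-sum (λ r → inverted (r x) (r y)) k n ≡ I + I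
  unmoved k k<n k≢q =
    r±-sum-fixed inverted x y (fixedBy-> k<n n<∣x∣) (fixedBy-≢ ∣y∣≡ (k≢q ∘ sym) (ℕP.<⇒≢ q<n))
  moved : r±-sum (λ r → inverted (r x) (r y)) q n ≡ + 1 + sgn x
  moved = trans (r±-sum-movedʳ inverted x y (ℕP.<⇒≢ q<n) (fixedBy-> q<n n<∣x∣) (inj₁ ∣y∣≡))
                (inverted-±ʳ-> x (r⁺ q n y) (subst (ℕ._< ∣ x ∣) (sym (∣r⁺∣-k y ∣y∣≡)) n<∣x∣))
  lemma : ∀ n I s → (n - + 1) * (n - + 2) * I + (n - + 1) * (+ 1 + s) + (n * (I + I) + ((+ 1 + s) - (I + I)))
                  ≡ (+ 1 + n - + 1) * (+ 1 + n - + 2) * I + (+ 1 + n - + 1) * (+ 1 + s)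
  lemma = solve-∀
...   | inj₂ refl =
  trans (cong₂ _+_ (∑T-constant q (λ r → inverted (r x) (r y)) I unmoved)
                   (trans (∑<-cong q moved) (∑<-const q (+ 1 + sgn x))))
        (lemma (+ q) I (sgn x))
  where
  I : ℤ
  I = inverted x y
  unmoved : ∀ k j → k ℕ.< j → j ℕ.< q → r±-sum (λ r → inverted (r x) (r y)) k j ≡ I + I
  unmoved k j k<j j<q = r±-sum-fixed inverted x y (fixedBy-> k<j (ℕP.<-trans (ℕ.s≤s j<q) n<∣x∣))
                                                  (fixedBy-≢ ∣y∣≡ (ℕP.>⇒≢ (ℕP.<-trans k<j j<q)) (ℕP.>⇒≢ j<q))
  moved : ∀ k → k ℕ.< q → r±-sum (λ r → inverted (r x) (r y)) k q ≡ + 1 + sgn x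
  moved k k<q = trans (r±-sum-movedʳ inverted x y (ℕP.<⇒≢ k<q) (fixedBy-> k<q n<∣x∣) (inj₂ ∣y∣≡))
                      (inverted-±ʳ-> x (r⁺ k q y)
                         (subst (ℕ._< ∣ x ∣) (sym (∣r⁺∣-j y ∣y∣≡)) (ℕP.<-trans (ℕ.s≤s k<q) n<∣x∣)))
  lemma : ∀ n I s → n * (n - + 1) * I + n * (+ 1 + s) ≡ (+ 1 + n - + 1) * (+ 1 + n - + 2) * I + (+ 1 + n - + 1) * (+ 1 + s)
  lemma = solve-∀

∑T-inverted-edge : ∀ n x y → ∣ x ∣ ≡ suc n → InRange n ∣ y ∣ →
  ∑T (suc n) (λ r → inverted (r x) (r y)) ≡ inverted x y * μ₂ (suc n) + + 2 * (+ suc n - + 1) + (φ x - φ y)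
∑T-inverted-edge n x y ∣x∣≡ y∈ with ∣ y ∣ in ∣y∣≡ | y∈
... | zero | () , _
... | suc q | _ , q<n =
  trans (cong₂ _+_ (∑T-inverted-outside n x y (subst (n ℕ.<_) (sym ∣x∣≡) ℕP.≤-refl) y∈)
                   (∑<-split n q (+ 1 - sgn y) (+ 1) (ℕP.<⇒≤ q<n) below above))
        arithmetic
  where
  ∣y∣<∣x∣ : ∣ y ∣ ℕ.< ∣ x ∣
  ∣y∣<∣x∣ = subst₂ ℕ._<_ (sym ∣y∣≡) (sym ∣x∣≡) (ℕ.s≤s q<n)
  below : ∀ k → k ℕ.< q → r±-sum (λ r → inverted (r x) (r y)) k n ≡ + 1 - sgn y
  below k k<q = trans (r±-sum-movedˡ inverted x y (ℕP.<⇒≢ (ℕP.<-trans k<q q<n)) (inj₂ ∣x∣≡)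
                                     (fixedBy-≢ ∣y∣≡ (ℕP.>⇒≢ k<q) (ℕP.<⇒≢ q<n)))
                      (inverted-±ˡ-> (r⁺ k n x) y (subst₂ ℕ._<_ (sym (∣r⁺∣-j x ∣x∣≡)) (sym ∣y∣≡) (ℕ.s≤s k<q)))
  above : ∀ k → q ℕ.≤ k → k ℕ.< n → r±-sum (λ r → inverted (r x) (r y)) k n ≡ + 1
  above k q≤k k<n with k ℕ.≟ q
  ... | yes refl = trans (r±-sum-moved² inverted x y (ℕP.<⇒≢ k<n) (inj₂ ∣x∣≡) (inj₁ ∣y∣≡))
                         (inverted-±² (r⁺ k n x) (r⁺ k n y)
                            (ℕP.<⇒≢ k<n ∘ ℕP.suc-injective
                               ∘ subst₂ _≡_ (∣r⁺∣-j x ∣x∣≡) (∣r⁺∣-k y ∣y∣≡) ∘ cong ∣_∣))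
  ... | no k≢q = trans (r±-sum-movedˡ inverted x y (ℕP.<⇒≢ k<n) (inj₂ ∣x∣≡)
                                      (fixedBy-≢ ∣y∣≡ (k≢q ∘ sym) (ℕP.<⇒≢ q<n)))
                       (inverted-±ˡ-< (r⁺ k n x) y
                          (subst₂ ℕ._<_ (sym ∣y∣≡) (sym (∣r⁺∣-j x ∣x∣≡))
                                  (ℕ.s≤s (ℕP.≤∧≢⇒< q≤k (k≢q ∘ sym)))))
  lemma : ∀ n I q sy → (n - + 1) * (n - + 2) * I + (n - + 1) * (+ 1 + (+ 2 * I - + 1)) + (q * (+ 1 - sy) + (n - q) * + 1)
                     ≡ I * ((+ 1 + n - + 1) * (+ 1 + n - + 4)) + + 2 * (+ 1 + n - + 1) + ((+ 2 * I - + 1) * n - sy * q)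
  lemma = solve-∀
  arithmetic : (+ n - + 1) * (+ n - + 2) * inverted x y + (+ n - + 1) * (+ 1 + sgn x) + (+ q * (+ 1 - sgn y) + (+ n - + q) * + 1)
               ≡ inverted x y * μ₂ (suc n) + + 2 * (+ suc n - + 1) + (φ x - φ y)
  arithmetic rewrite φ≡sgn*pred∣∣ x n ∣x∣≡ | φ≡sgn*pred∣∣ y q ∣y∣≡ | sgn≡2*inverted-1 x y ∣y∣<∣x∣ =
    lemma (+ n) (inverted x y) (+ q) (sgn y)

∑T-inverted-edgeʳ : ∀ n x y → ∣ y ∣ ≡ suc n → InRange n ∣ x ∣ →
  ∑T (suc n) (λ r → inverted (r x) (r y)) ≡ inverted x y * μ₂ (suc n) + + 2 * (+ suc n - + 1) + (φ x - φ y)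
∑T-inverted-edgeʳ n x y ∣y∣≡ x∈ =
  trans (∑T-inverted-flip (suc n) y x (∣x∣≢∣y∣ ∘ sym))
  (trans (cong (_-_ (μ₀ (suc n))) (∑T-inverted-edge n y x ∣y∣≡ x∈))
  (trans (cong (λ z → μ₀ (suc n) - (z * μ₂ (suc n) + + 2 * (+ suc n - + 1) + (φ y - φ x)))
               (inverted-flip {x} {y} (∣x∣≢∣y∣ ∘ cong ∣_∣)))
         (lemma (+ suc n) (inverted x y) (φ x) (φ y))))
  where
  ∣x∣≢∣y∣ : ∣ x ∣ ≢ ∣ y ∣
  ∣x∣≢∣y∣ e = ℕP.<-irrefl refl (subst (ℕ._≤ n) (trans e ∣y∣≡) (proj₂ x∈))
  lemma : ∀ N I px py → N * (N - + 1) - ((+ 1 - I) * ((N - + 1) * (N - + 4)) + + 2 * (N - + 1) + (py - px))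
                      ≡ I * ((N - + 1) * (N - + 4)) + + 2 * (N - + 1) + (px - py)
  lemma = solve-∀

∑T-inverted : ∀ n x y → Admissible n x y →
  ∑T n (λ r → inverted (r x) (r y)) ≡ inverted x y * μ₂ n + + 2 * (+ n - + 1) + (φ x - φ y)
∑T-inverted zero x y ((1≤∣x∣ , ∣x∣≤0) , _) = ⊥-elim (ℕP.<-irrefl refl (ℕP.≤-trans 1≤∣x∣ ∣x∣≤0))
∑T-inverted (suc n) x y (x∈ , y∈ , ∣x∣≢∣y∣)
  with ∣ x ∣ in ∣x∣≡ | ∣ y ∣ in ∣y∣≡ | x∈ | y∈ | ∣x∣≢∣y∣
... | zero | _ | () , _ | _ | _
... | _ | zero | _ | () , _ | _
... | suc p | suc q | _ , p<1+n | _ , q<1+n | 1+p≢1+q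
  with ℕP.m≤n⇒m<n∨m≡n (ℕP.≤-pred p<1+n) | ℕP.m≤n⇒m<n∨m≡n (ℕP.≤-pred q<1+n)
...   | inj₂ refl | inj₂ refl = ⊥-elim (1+p≢1+q refl)
...   | inj₂ refl | inj₁ q<n = ∑T-inverted-edge p x y ∣x∣≡ (inRange-∣∣ y ∣y∣≡ q<n)
...   | inj₁ p<n | inj₂ refl = ∑T-inverted-edgeʳ q x y ∣y∣≡ (inRange-∣∣ x ∣x∣≡ p<n)
...   | inj₁ p<n | inj₁ q<n =
  trans (cong₂ _+_ (∑T-inverted n x y (inRange-∣∣ x ∣x∣≡ p<n , inRange-∣∣ y ∣y∣≡ q<n ,
                                       1+p≢1+q ∘ subst₂ _≡_ ∣x∣≡ ∣y∣≡))
                   (∑<-except₂ n p q (I + I) p<n q<n (1+p≢1+q ∘ cong suc) unmoved))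
  (trans (cong₂ (λ a b → previous + (+ n * (I + I) + (a - (I + I)) + (b - (I + I)))) moved-x moved-y)
         (lemma (+ n) I (φ x - φ y)))
  where
  I : ℤ
  I = inverted x y
  previous : ℤ
  previous = I * ((+ n - + 1) * (+ n - + 4)) + + 2 * (+ n - + 1) + (φ x - φ y)
  unmoved : ∀ k → k ℕ.< n → k ≢ p → k ≢ q → r±-sum (λ r → inverted (r x) (r y)) k n ≡ I + I
  unmoved k k<n k≢p k≢q = r±-sum-fixed inverted x y (fixedBy-≢ ∣x∣≡ (k≢p ∘ sym) (ℕP.<⇒≢ p<n))
                                                    (fixedBy-≢ ∣y∣≡ (k≢q ∘ sym) (ℕP.<⇒≢ q<n))
  moved-x : r±-sum (λ r → inverted (r x) (r y)) p n ≡ + 1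
  moved-x = trans (r±-sum-movedˡ inverted x y (ℕP.<⇒≢ p<n) (inj₁ ∣x∣≡)
                                 (fixedBy-≢ ∣y∣≡ (1+p≢1+q ∘ cong suc ∘ sym) (ℕP.<⇒≢ q<n)))
                  (inverted-±ˡ-< (r⁺ p n x) y (subst₂ ℕ._<_ (sym ∣y∣≡) (sym (∣r⁺∣-k x ∣x∣≡)) (ℕ.s≤s q<n)))
  moved-y : r±-sum (λ r → inverted (r x) (r y)) q n ≡ + 1
  moved-y = trans (r±-sum-movedʳ inverted x y (ℕP.<⇒≢ q<n)
                                 (fixedBy-≢ ∣x∣≡ (1+p≢1+q ∘ cong suc) (ℕP.<⇒≢ p<n)) (inj₁ ∣y∣≡))
                  (inverted-±ʳ-< x (r⁺ q n y) (subst₂ ℕ._<_ (sym ∣x∣≡) (sym (∣r⁺∣-k y ∣y∣≡)) (ℕ.s≤s p<n)))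
  lemma : ∀ n I D → I * ((n - + 1) * (n - + 4)) + + 2 * (n - + 1) + D + (n * (I + I) + (+ 1 - (I + I)) + (+ 1 - (I + I)))
                  ≡ I * ((+ 1 + n - + 1) * (+ 1 + n - + 4)) + + 2 * (+ 1 + n - + 1) + D
  lemma = solve-∀

-- The closed form for the number of inversions

closedForm : ℕ → ℕ → ℤ → ℤ → ℤ
closedForm n t x y =
  (+ n - + 1) * μ₀ n ^ t + μ₁ n ^ t * (φ x - φ y) + μ₂ n ^ t * ((+ n - + 1) * (+ 2 * inverted x y - + 1) - (φ x - φ y))

κ₀ κ₁ κ₂ κ₃ : ℕ → ℕ → ℤ
κ₀ n t = (+ n - + 1) * (μ₀ n ^ t - μ₂ n ^ t)
κ₁ n t = μ₁ n ^ t - μ₂ n ^ t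
κ₂ n t = μ₂ n ^ t - μ₁ n ^ t
κ₃ n t = + 2 * (+ n - + 1) * μ₂ n ^ t

closedForm-affine : ∀ n t x y →
  closedForm n t x y ≡ κ₀ n t + κ₁ n t * φ x + κ₂ n t * φ y + κ₃ n t * inverted x y
closedForm-affine n t x y = lemma (+ n) (μ₀ n ^ t) (μ₁ n ^ t) (μ₂ n ^ t) (φ x) (φ y) (inverted x y)
  where
  lemma : ∀ ν A α β px py I → (ν - + 1) * A + α * (px - py) + β * ((ν - + 1) * (+ 2 * I - + 1) - (px - py))
                            ≡ (ν - + 1) * (A - β) + (α - β) * px + (β - α) * py + + 2 * (ν - + 1) * β * I
  lemma = solve-∀

inversions-closedForm : ∀ n t x y → Admissible n x y → + 2 * (+ n - + 1) * inversions n t x y ≡ closedForm n t x y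
inversions-closedForm n zero x y _ = lemma (+ n) (inverted x y) (φ x) (φ y)
  where
  lemma : ∀ n I px py → + 2 * (n - + 1) * (I + + 0)
                      ≡ (n - + 1) * + 1 + + 1 * (px - py) + + 1 * ((n - + 1) * (+ 2 * I - + 1) - (px - py))
  lemma = solve-∀
inversions-closedForm n (suc t) x y adm@(x∈ , y∈ , _) =
  begin
    c * inversions n (suc t) x y
  ≡⟨ cong (c *_) (inversions-suc n t x y) ⟩
    c * ∑T n (λ r → inversions n t (r x) (r y))
  ≡⟨ sym (∑pairs-* n c (λ i j → inversions n t (reflection i j x) (reflection i j y))) ⟩
    ∑T n (λ r → c * inversions n t (r x) (r y))
  ≡⟨ ∑pairs-cong n {λ i j → c * inversions n t (reflection i j x) (reflection i j y)}
                   {λ i j → c₀ + c₁ * φ (reflection i j x) + c₂ * φ (reflection i j y)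
                             + c₃ * inverted (reflection i j x) (reflection i j y)}
                   (λ k j k<j j<n → cong₂ _+_ (step -[1+ k ] (+ suc j) (inRange-suc (ℕP.<-trans k<j j<n)) (inRange-suc j<n))
                                              (step (+ suc k) (+ suc j) (inRange-suc (ℕP.<-trans k<j j<n)) (inRange-suc j<n))) ⟩
    ∑T n (λ r → c₀ + c₁ * φ (r x) + c₂ * φ (r y) + c₃ * inverted (r x) (r y))
  ≡⟨ ∑pairs-affine n c₀ c₁ c₂ c₃ (λ i j → φ (reflection i j x)) (λ i j → φ (reflection i j y))
                                 (λ i j → inverted (reflection i j x) (reflection i j y)) ⟩
    μ₀ n * c₀ + c₁ * ∑T n (λ r → φ (r x)) + c₂ * ∑T n (λ r → φ (r y)) + c₃ * ∑T n (λ r → inverted (r x) (r y))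
  ≡⟨ cong₂ (λ a b → μ₀ n * c₀ + c₁ * a + c₂ * b + c₃ * ∑T n (λ r → inverted (r x) (r y)))
            (∑T-φ n x x∈) (∑T-φ n y y∈) ⟩
    μ₀ n * c₀ + c₁ * (μ₁ n * φ x) + c₂ * (μ₁ n * φ y) + c₃ * ∑T n (λ r → inverted (r x) (r y))
  ≡⟨ cong (λ d → μ₀ n * c₀ + c₁ * (μ₁ n * φ x) + c₂ * (μ₁ n * φ y) + c₃ * d) (∑T-inverted n x y adm) ⟩
    μ₀ n * c₀ + c₁ * (μ₁ n * φ x) + c₂ * (μ₁ n * φ y) + c₃ * (inverted x y * μ₂ n + + 2 * (+ n - + 1) + (φ x - φ y))
  ≡⟨ regroup (+ n) (μ₀ n ^ t) (μ₁ n ^ t) (μ₂ n ^ t) (φ x) (φ y) (inverted x y) ⟩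
    closedForm n (suc t) x y
  ∎
  where
  open ≡-Reasoning
  c c₀ c₁ c₂ c₃ : ℤ
  c = + 2 * (+ n - + 1)
  c₀ = κ₀ n t
  c₁ = κ₁ n t
  c₂ = κ₂ n t
  c₃ = κ₃ n t
  step : ∀ i j → InRange n ∣ i ∣ → InRange n ∣ j ∣ →
    c * inversions n t (reflection i j x) (reflection i j y)
      ≡ c₀ + c₁ * φ (reflection i j x) + c₂ * φ (reflection i j y) + c₃ * inverted (reflection i j x) (reflection i j y)
  step i j i∈ j∈ =
    trans (inversions-closedForm n t (reflection i j x) (reflection i j y) (admissible-reflection n i j {x} {y} i∈ j∈ adm))
          (closedForm-affine n t (reflection i j x) (reflection i j y))
  regroup : ∀ ν A α β px py I →
    ν * (ν - + 1) * ((ν - + 1) * (A - β)) + (α - β) * ((ν - + 1) * (ν - + 2) * px) + (β - α) * ((ν - + 1) * (ν - + 2) * py)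
      + + 2 * (ν - + 1) * β * (I * ((ν - + 1) * (ν - + 4)) + + 2 * (ν - + 1) + (px - py))
    ≡ (ν - + 1) * (ν * (ν - + 1) * A) + (ν - + 1) * (ν - + 2) * α * (px - py)
      + (ν - + 1) * (ν - + 4) * β * ((ν - + 1) * (+ 2 * I - + 1) - (px - py))
  regroup = solve-∀

-- Summing over the D-inversion pairs

pos-^ : ∀ m t → + (m ℕ.^ t) ≡ (+ m) ^ t
pos-^ m zero = refl
pos-^ m (suc t) = trans (ℤP.pos-* m (m ℕ.^ t)) (cong (_*_ (+ m)) (pos-^ m t))

^-distrib-* : ∀ x y t → (x * y) ^ t ≡ x ^ t * y ^ t
^-distrib-* x y zero = refl
^-distrib-* x y (suc t) rewrite ^-distrib-* x y t = lemma x y (x ^ t) (y ^ t)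
  where
  lemma : ∀ x y a b → x * y * (a * b) ≡ x * a * (y * b)
  lemma = solve-∀

admissible-pair : ∀ {n i j} → i ≢ + 0 → + ∣ i ∣ ℤ.< j → j ℤ.≤ + n → Admissible n i j
admissible-pair {j = + j} i≢0 (ℤ.+<+ ∣i∣<j) (ℤ.+≤+ j≤n) =
  (ℕP.n≢0⇒n>0 (i≢0 ∘ ℤP.∣i∣≡0⇒i≡0) , ℕP.≤-trans (ℕP.<⇒≤ ∣i∣<j) j≤n) ,
  (ℕP.≤-trans (ℕ.s≤s ℕ.z≤n) ∣i∣<j , j≤n) ,
  ℕP.<⇒≢ ∣i∣<j

pair-not-inverted : ∀ {i j} → + ∣ i ∣ ℤ.< j → inverted i j ≡ + 0
pair-not-inverted {+ m} ∣i∣<j = inverted-no (ℤP.<-asym ∣i∣<j)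
pair-not-inverted { -[1+ m ]} ∣i∣<j = inverted-no (λ j<i → ℤP.<-asym (ℤP.<-trans j<i ℤ.-<+) ∣i∣<j)

φ≡-sgn : ∀ x → x ≢ + 0 → φ x ≡ x - sgn x
φ≡-sgn (+ zero) x≢0 = ⊥-elim (x≢0 refl)
φ≡-sgn (+ suc m) _ = refl
φ≡-sgn -[1+ zero ] _ = refl
φ≡-sgn -[1+ suc m ] _ = refl

φ-difference : ∀ {i j} → i ≢ + 0 → + ∣ i ∣ ℤ.< j → φ i - φ j ≡ - (j - i - + 1 + sgn i)
φ-difference {i} {+ zero} i≢0 (ℤ.+<+ ())
φ-difference {i} {+ suc j} i≢0 _ rewrite φ≡-sgn i i≢0 = lemma i (sgn i) (+ j)
  where
  lemma : ∀ i s j → i - s - j ≡ - (+ 1 + j - i - + 1 + s)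
  lemma = solve-∀

closedForm-pair : ∀ n t {i j} → i ≢ + 0 → + ∣ i ∣ ℤ.< j → closedForm n t i j ≡
  (+ n - + 1) * μ₀ n ^ t - μ₁ n ^ t * (j - i - + 1 + sgn i) + μ₂ n ^ t * ((j - i - + 1 + sgn i) - (+ n - + 1))
closedForm-pair n t {i} {j} i≢0 ∣i∣<j rewrite pair-not-inverted {i} ∣i∣<j | φ-difference i≢0 ∣i∣<j =
  lemma (+ n - + 1) (μ₀ n ^ t) (μ₁ n ^ t) (μ₂ n ^ t) (j - i - + 1 + sgn i)
  where
  lemma : ∀ ν′ A α β d → ν′ * A + α * - d + β * (ν′ * (+ 2 * + 0 - + 1) - - d) ≡ ν′ * A - α * d + β * (d - ν′)
  lemma = solve-∀

∑pairs-on-pairs : ∀ n {G H : ℤ → ℤ → ℤ} →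
  (∀ i j → i ≢ + 0 → + ∣ i ∣ ℤ.< j → j ℤ.≤ + n → G i j ≡ H i j) → ∑pairs n G ≡ ∑pairs n H
∑pairs-on-pairs n {G} {H} G≗H = ∑pairs-cong n {G} {H} λ k j k<j j<n →
  cong₂ _+_ (G≗H -[1+ k ] (+ suc j) (λ ()) (ℤ.+<+ (ℕ.s≤s k<j)) (ℤ.+≤+ j<n))
            (G≗H (+ suc k) (+ suc j) (λ ()) (ℤ.+<+ (ℕ.s≤s k<j)) (ℤ.+≤+ j<n))

∑pairs-zero : ∀ n {G : ℤ → ℤ → ℤ} → (∀ i j → i ≢ + 0 → + ∣ i ∣ ℤ.< j → j ℤ.≤ + n → G i j ≡ + 0) →
  ∑pairs n G ≡ + 0
∑pairs-zero n {G} G≗0 =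
  trans (∑pairs-on-pairs n {G} {λ _ _ → + 0} G≗0) (trans (∑pairs-const n (+ 0)) (ℤP.*-zeroʳ (μ₀ n)))

∑pairs-inverted : ∀ n → ∑pairs n inverted ≡ + 0
∑pairs-inverted n = ∑pairs-zero n (λ i j _ ∣i∣<j _ → pair-not-inverted {i} ∣i∣<j)

∑pairs-φ-first : ∀ n → ∑pairs n (λ i _ → φ i) ≡ + 0
∑pairs-φ-first n =
  trans (∑pairs-cong n {G = λ i _ → φ i} {H = λ _ _ → + 0} (λ k _ _ _ → ℤP.+-inverseˡ (+ k)))
        (trans (∑pairs-const n (+ 0)) (ℤP.*-zeroʳ (μ₀ n)))

∑pairs-φ-second : ∀ n → + 3 * ∑pairs n (λ _ j → φ j) ≡ (+ n - + 1) * + n * (+ 2 * + n - + 1)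
∑pairs-φ-second n = trans (cong (_*_ (+ 3)) (∑<-cong n (λ j _ → ∑<-const j (+ j + + j)))) (sum-of-squares n)
  where
  sum-of-squares : ∀ n → + 3 * ∑< n (λ j → + j * (+ j + + j)) ≡ (+ n - + 1) * + n * (+ 2 * + n - + 1)
  sum-of-squares zero = refl
  sum-of-squares (suc n)
    rewrite ℤP.*-distribˡ-+ (+ 3) (∑< n (λ j → + j * (+ j + + j))) (+ n * (+ n + + n)) | sum-of-squares n = lemma (+ n)
    where
    lemma : ∀ x → (x - + 1) * x * (+ 2 * x - + 1) + + 3 * (x * (x + x))
                ≡ (+ 1 + x - + 1) * (+ 1 + x) * (+ 2 * (+ 1 + x) - + 1)
    lemma = solve-∀

sum-map : ∀ {A : Set} (f : A → ℕ) xs → + sum (map f xs) ≡ ∑ (λ x → + f x) xs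
sum-map f [] = refl
sum-map f (x ∷ xs) = trans (ℤP.pos-+ (f x) _) (cong (_+_ (+ f x)) (sum-map f xs))

∑-lengths : ∀ n t → + sum (map (len n) (products n t)) ≡ ∑pairs n (inversions n t)
∑-lengths n t =
  trans (sum-map (len n) (products n t))
  (trans (∑-cong (λ π → length-filter (λ p → π (proj₂ p) ℤ.<? π (proj₁ p)) (pairs n)) (products n t))
  (trans (∑-swap (λ π p → 𝟙 (π (proj₂ p) ℤ.<? π (proj₁ p))) (products n t) (pairs n))
         (∑-pairs n (inversions n t))))

∑-lengths-closedForm : ∀ n t →
  + 3 * (+ 2 * (+ n - + 1) * + sum (map (len n) (products n t)))
    ≡ + 3 * (μ₀ n * κ₀ n t) + κ₂ n t * ((+ n - + 1) * + n * (+ 2 * + n - + 1))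
∑-lengths-closedForm n t =
  begin
    + 3 * (c * + sum (map (len n) (products n t)))
  ≡⟨ cong (λ z → + 3 * (c * z)) (∑-lengths n t) ⟩
    + 3 * (c * ∑pairs n (inversions n t))
  ≡⟨ cong (+ 3 *_) (sym (∑pairs-* n c (inversions n t))) ⟩
    + 3 * ∑pairs n (λ i j → c * inversions n t i j)
  ≡⟨ cong (+ 3 *_) (∑pairs-on-pairs n {λ i j → c * inversions n t i j}
                                      {λ i j → c₀ + c₁ * φ i + c₂ * φ j + c₃ * inverted i j}
                      (λ i j i≢0 ∣i∣<j j≤n → trans (inversions-closedForm n t i j (admissible-pair i≢0 ∣i∣<j j≤n))
                                                  (closedForm-affine n t i j))) ⟩
    + 3 * ∑pairs n (λ i j → c₀ + c₁ * φ i + c₂ * φ j + c₃ * inverted i j)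
  ≡⟨ cong (+ 3 *_) (∑pairs-affine n c₀ c₁ c₂ c₃ (λ i _ → φ i) (λ _ j → φ j) inverted) ⟩
    + 3 * (μ₀ n * c₀ + c₁ * ∑pairs n (λ i _ → φ i) + c₂ * ∑pairs n (λ _ j → φ j) + c₃ * ∑pairs n inverted)
  ≡⟨ cong₂ (λ a b → + 3 * (μ₀ n * c₀ + c₁ * a + c₂ * ∑pairs n (λ _ j → φ j) + c₃ * b))
            (∑pairs-φ-first n) (∑pairs-inverted n) ⟩
    + 3 * (μ₀ n * c₀ + c₁ * + 0 + c₂ * ∑pairs n (λ _ j → φ j) + c₃ * + 0)
  ≡⟨ lemma (μ₀ n * c₀) c₁ c₂ c₃ (∑pairs n (λ _ j → φ j)) ⟩
    + 3 * (μ₀ n * c₀) + c₂ * (+ 3 * ∑pairs n (λ _ j → φ j))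
  ≡⟨ cong (λ z → + 3 * (μ₀ n * c₀) + c₂ * z) (∑pairs-φ-second n) ⟩
    + 3 * (μ₀ n * c₀) + c₂ * ((+ n - + 1) * + n * (+ 2 * + n - + 1))
  ∎
  where
  open ≡-Reasoning
  c c₀ c₁ c₂ c₃ : ℤ
  c = + 2 * (+ n - + 1)
  c₀ = κ₀ n t
  c₁ = κ₁ n t
  c₂ = κ₂ n t
  c₃ = κ₃ n t
  lemma : ∀ a c₁ c₂ c₃ s → + 3 * (a + c₁ * + 0 + c₂ * s + c₃ * + 0) ≡ + 3 * a + c₂ * (+ 3 * s)
  lemma = solve-∀

length-T : ∀ n → + length (T n) ≡ μ₀ n
length-T n =
  trans (length≡∑1 (T n)) (trans (∑-T n (λ _ → + 1)) (trans (∑pairs-const n (+ 1)) (ℤP.*-identityʳ (μ₀ n))))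

-- q ≐ a ÷ b: q = a / b with b > 0; it reduces identities in ℚ to cross-multiplied ones in ℤ.
infix 4 _≐_÷_
data _≐_÷_ (q : ℚ) (a b : ℤ) : Set where
  fraction : ∀ d → q ≡ a ℚ./ suc d → + suc d ≡ b → q ≐ a ÷ b

toℚᵘ-/ : ∀ a d → ℚ.toℚᵘ (a ℚ./ suc d) ℚᵘ.≃ mkℚᵘ a d
toℚᵘ-/ a d = *≡* (begin
    ℚᵘ.↥ ℚ.toℚᵘ q * + suc d ≡⟨ cong (_* + suc d) (ℚP.↥ᵘ-toℚᵘ q) ⟩
    ↥ q * + suc d           ≡⟨ cong (↥ q *_) (sym (ℚP.↧-/ a (suc d))) ⟩
    ↥ q * (↧ q * g)         ≡⟨ swap (↥ q) (↧ q) g ⟩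
    ↥ q * g * ↧ q           ≡⟨ cong (_* ↧ q) (ℚP.↥-/ a (suc d)) ⟩
    a * ↧ q                 ≡⟨ cong (a *_) (sym (ℚP.↧ᵘ-toℚᵘ q)) ⟩
    a * ℚᵘ.↧ ℚ.toℚᵘ q       ∎)
  where
  open ≡-Reasoning
  q = a ℚ./ suc d
  g = gcd a (+ suc d)
  swap : ∀ x y g → x * (y * g) ≡ x * g * y
  swap = solve-∀

from-≃ : ∀ {p} a d → ℚ.toℚᵘ p ℚᵘ.≃ mkℚᵘ a d → p ≡ a ℚ./ suc d
from-≃ a d p≃ = ℚP.toℚᵘ-injective (ℚᵘP.≃-trans p≃ (ℚᵘP.≃-sym (toℚᵘ-/ a d)))

≐-≡ : ∀ {p q a b c d} → p ≐ a ÷ b → q ≐ c ÷ d → a * d ≡ c * b → p ≡ q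
≐-≡ {a = a} {c = c} (fraction b refl refl) (fraction d refl refl) ad≡cb =
  from-≃ c d (ℚᵘP.≃-trans (toℚᵘ-/ a b) (*≡* ad≡cb))

≐-+ : ∀ {p q a b c d} → p ≐ a ÷ b → q ≐ c ÷ d → p ℚ.+ q ≐ a * d + c * b ÷ b * d
≐-+ {a = a} {c = c} (fraction b refl refl) (fraction d refl refl) =
  fraction (ℕ.pred (suc b ℕ.* suc d))
    (from-≃ (a * + suc d + c * + suc b) (ℕ.pred (suc b ℕ.* suc d))
       (ℚᵘP.≃-trans (ℚP.toℚᵘ-homo-+ (a ℚ./ suc b) (c ℚ./ suc d)) (ℚᵘP.+-cong (toℚᵘ-/ a b) (toℚᵘ-/ c d))))
    (ℤP.pos-* (suc b) (suc d))

≐-* : ∀ {p q a b c d} → p ≐ a ÷ b → q ≐ c ÷ d → p ℚ.* q ≐ a * c ÷ b * d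
≐-* {a = a} {c = c} (fraction b refl refl) (fraction d refl refl) =
  fraction (ℕ.pred (suc b ℕ.* suc d))
    (from-≃ (a * c) (ℕ.pred (suc b ℕ.* suc d))
       (ℚᵘP.≃-trans (ℚP.toℚᵘ-homo-* (a ℚ./ suc b) (c ℚ./ suc d)) (ℚᵘP.*-cong (toℚᵘ-/ a b) (toℚᵘ-/ c d))))
    (ℤP.pos-* (suc b) (suc d))

≐-neg : ∀ {p a b} → p ≐ a ÷ b → ℚ.- p ≐ - a ÷ b
≐-neg {a = a} (fraction b refl refl) =
  fraction b (from-≃ (- a) b (ℚᵘP.≃-trans (ℚP.toℚᵘ-homo‿- (a ℚ./ suc b)) (ℚᵘP.-‿cong (toℚᵘ-/ a b)))) refl

≐-- : ∀ {p q a b c d} → p ≐ a ÷ b → q ≐ c ÷ d → p ℚ.- q ≐ a * d + (- c) * b ÷ b * d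
≐-- p≐ q≐ = ≐-+ p≐ (≐-neg q≐)

≐-1 : ℚ.1ℚ ≐ + 1 ÷ + 1
≐-1 = fraction 0 refl refl

≐-frac : ∀ a d → 0 ℕ.< d → frac a d ≐ a ÷ + d
≐-frac a (suc d) _ = fraction d refl refl

≐-^ℚ : ∀ {p a b} t → p ≐ a ÷ b → p ^ℚ t ≐ a ^ t ÷ b ^ t
≐-^ℚ zero _ = ≐-1
≐-^ℚ (suc t) p≐ = ≐-* p≐ (≐-^ℚ t p≐)

≐-cong : ∀ {p a a′ b b′} → p ≐ a ÷ b → a ≡ a′ → b ≡ b′ → p ≐ a′ ÷ b′
≐-cong p≐ refl refl = p≐

module _ (m t : ℕ) where
  private
    n : ℕ
    n = suc (suc m)
    ν P Q R₂ R₄ C : ℤ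
    ν = + n
    P = ν ^ t
    Q = (ν - + 1) ^ t
    R₂ = (ν - + 2) ^ t
    R₄ = (ν - + 4) ^ t
    C = + 2 * (ν - + 1)

    μ₀^t : μ₀ n ^ t ≡ P * Q
    μ₀^t = ^-distrib-* ν (ν - + 1) t

    μ₁^t : μ₁ n ^ t ≡ Q * R₂
    μ₁^t = ^-distrib-* (ν - + 1) (ν - + 2) t

    μ₂^t : μ₂ n ^ t ≡ Q * R₄
    μ₂^t = ^-distrib-* (ν - + 1) (ν - + 4) t

    over-|T|^t : ∀ a → frac a (length (T n) ℕ.^ t) ≐ a ÷ P * Q
    over-|T|^t a = ≐-cong (≐-frac a (length (T n) ℕ.^ t) |T|^t>0) refl
                          (trans (pos-^ (length (T n)) t) (trans (cong (_^ t) (length-T n)) μ₀^t))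
      where
      |T|^t>0 : 0 ℕ.< length (T n) ℕ.^ t
      |T|^t>0 rewrite ℤP.+-injective (length-T n) = ℕP.m^n>0 (n ℕ.* suc m) t

    1-c/n : ∀ c → (ℚ.1ℚ ℚ.- frac (+ c) n) ^ℚ t ≐ (ν - + c) ^ t ÷ P
    1-c/n c = ≐-^ℚ t (≐-cong (≐-- ≐-1 (≐-frac (+ c) n (ℕ.s≤s ℕ.z≤n))) (lemma ν (+ c)) (ℤP.*-identityˡ ν))
      where
      lemma : ∀ x c → + 1 * x + (- c) * + 1 ≡ x - c
      lemma = solve-∀

  expected-length : E n t ≡ frac (+ n ℤ.* (+ n ℤ.- + 1)) 2
              ℚ.- frac (+ n ℤ.* (+ 2 ℤ.* + n ℤ.- + 1)) 6 ℚ.* ((ℚ.1ℚ ℚ.- frac (+ 2) n) ^ℚ t)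
              ℚ.- frac (+ n ℤ.* (+ n ℤ.- + 2)) 6 ℚ.* ((ℚ.1ℚ ℚ.- frac (+ 4) n) ^ℚ t)
  expected-length =
    ≐-≡ (over-|T|^t S)
        (≐-- (≐-- (≐-frac (ν * (ν - + 1)) 2 (ℕ.s≤s ℕ.z≤n))
                  (≐-* (≐-frac (ν * (+ 2 * ν - + 1)) 6 (ℕ.s≤s ℕ.z≤n)) (1-c/n 2)))
             (≐-* (≐-frac (ν * (ν - + 2)) 6 (ℕ.s≤s ℕ.z≤n)) (1-c/n 4)))
        -- cross-multiplied and scaled by 3 · 2(n − 1), so that the summed closed form can be substituted
        (ℤP.*-cancelʳ-≡ _ _ (+ 3 * C)
           (trans (regroup S den C) (trans (cong (_* den) summed) (cross-multiplied ν P Q R₂ R₄))))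
    where
    S den : ℤ
    S = + sum (map (len n) (products n t))
    den = + 2 * (+ 6 * P) * (+ 6 * P)
    summed : + 3 * (C * S) ≡ + 3 * (μ₀ n * ((ν - + 1) * (P * Q - Q * R₄))) + (Q * R₄ - Q * R₂) * ((ν - + 1) * ν * (+ 2 * ν - + 1))
    summed = trans (∑-lengths-closedForm n t) powers
      where
      powers : + 3 * (μ₀ n * κ₀ n t) + κ₂ n t * ((ν - + 1) * ν * (+ 2 * ν - + 1))
             ≡ + 3 * (μ₀ n * ((ν - + 1) * (P * Q - Q * R₄))) + (Q * R₄ - Q * R₂) * ((ν - + 1) * ν * (+ 2 * ν - + 1))
      powers rewrite μ₀^t | μ₁^t | μ₂^t = refl
    regroup : ∀ S d k → S * d * (+ 3 * k) ≡ + 3 * (k * S) * d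
    regroup = solve-∀
    cross-multiplied : ∀ ν P Q R₂ R₄ →
      (+ 3 * (ν * (ν - + 1) * ((ν - + 1) * (P * Q - Q * R₄))) + (Q * R₄ - Q * R₂) * ((ν - + 1) * ν * (+ 2 * ν - + 1)))
        * (+ 2 * (+ 6 * P) * (+ 6 * P))
      ≡ ((ν * (ν - + 1) * (+ 6 * P) + - (ν * (+ 2 * ν - + 1) * R₂) * + 2) * (+ 6 * P) + - (ν * (ν - + 2) * R₄) * (+ 2 * (+ 6 * P)))
        * (P * Q) * (+ 3 * (+ 2 * (ν - + 1)))
    cross-multiplied = solve-∀

  inversion-probability : (i j : ℤ) → i ≢ + 0 → + ∣ i ∣ ℤ.< j → j ℤ.≤ + n →
    Prob n t i j ≡ frac (+ 1) 2
      ℚ.- frac (j ℤ.- i ℤ.- + 1 ℤ.+ sgn i) (2 ℕ.* (n ∸ 1)) ℚ.* ((ℚ.1ℚ ℚ.- frac (+ 2) n) ^ℚ t)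
      ℚ.+ (frac (j ℤ.- i ℤ.- + 1 ℤ.+ sgn i) (2 ℕ.* (n ∸ 1)) ℚ.- frac (+ 1) 2) ℚ.* ((ℚ.1ℚ ℚ.- frac (+ 4) n) ^ℚ t)
  inversion-probability i j i≢0 ∣i∣<j j≤n =
    ≐-≡ (≐-cong (over-|T|^t _) (length-filter (λ π → π j ℤ.<? π i) (products n t)) refl)
        (≐-+ (≐-- ½ (≐-* D/C (1-c/n 2))) (≐-* (≐-- D/C ½) (1-c/n 4)))
        (ℤP.*-cancelʳ-≡ _ _ C
           (trans (regroup (inversions n t i j) _ C) (trans (cong (_* _) closed) (cross-multiplied ν P Q R₂ R₄ D))))
    where
    D : ℤ
    D = j - i - + 1 + sgn i
    ½ : frac (+ 1) 2 ≐ + 1 ÷ + 2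
    ½ = ≐-frac (+ 1) 2 (ℕ.s≤s ℕ.z≤n)
    D/C : frac D (2 ℕ.* (n ∸ 1)) ≐ D ÷ C
    D/C = ≐-cong (≐-frac D (2 ℕ.* (n ∸ 1)) (ℕ.s≤s ℕ.z≤n)) refl (ℤP.pos-* 2 (suc m))
    closed : C * inversions n t i j ≡ (ν - + 1) * (P * Q) - Q * R₂ * D + Q * R₄ * (D - (ν - + 1))
    closed = trans (inversions-closedForm n t i j (admissible-pair i≢0 ∣i∣<j j≤n))
                   (trans (closedForm-pair n t i≢0 ∣i∣<j) powers)
      where
      powers : (ν - + 1) * μ₀ n ^ t - μ₁ n ^ t * D + μ₂ n ^ t * (D - (ν - + 1))
             ≡ (ν - + 1) * (P * Q) - Q * R₂ * D + Q * R₄ * (D - (ν - + 1))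
      powers rewrite μ₀^t | μ₁^t | μ₂^t = refl
    regroup : ∀ N d c → N * d * c ≡ c * N * d
    regroup = solve-∀
    cross-multiplied : ∀ ν P Q R₂ R₄ d →
      ((ν - + 1) * (P * Q) - Q * R₂ * d + Q * R₄ * (d - (ν - + 1))) * ((+ 2 * ((+ 2 * (ν - + 1)) * P)) * ((+ 2 * (ν - + 1)) * + 2 * P))
      ≡ ((+ 1 * ((+ 2 * (ν - + 1)) * P) + - (d * R₂) * + 2) * ((+ 2 * (ν - + 1)) * + 2 * P)
         + ((d * + 2 + - + 1 * (+ 2 * (ν - + 1))) * R₄) * (+ 2 * ((+ 2 * (ν - + 1)) * P))) * (P * Q) * (+ 2 * (ν - + 1))
    cross-multiplied = solve-∀

mainTheorem7 : (n t : ℕ) → 2 ℕ.≤ n →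
    (E n t ≡ frac (+ n ℤ.* (+ n ℤ.- + 1)) 2
              ℚ.- frac (+ n ℤ.* (+ 2 ℤ.* + n ℤ.- + 1)) 6 ℚ.* ((ℚ.1ℚ ℚ.- frac (+ 2) n) ^ℚ t)
              ℚ.- frac (+ n ℤ.* (+ n ℤ.- + 2)) 6 ℚ.* ((ℚ.1ℚ ℚ.- frac (+ 4) n) ^ℚ t))
    × ((i j : ℤ) → i ≢ + 0 → + ∣ i ∣ ℤ.< j → j ℤ.≤ + n →
        Prob n t i j ≡ frac (+ 1) 2
          ℚ.- frac (j ℤ.- i ℤ.- + 1 ℤ.+ sgn i) (2 ℕ.* (n ∸ 1)) ℚ.* ((ℚ.1ℚ ℚ.- frac (+ 2) n) ^ℚ t)
          ℚ.+ (frac (j ℤ.- i ℤ.- + 1 ℤ.+ sgn i) (2 ℕ.* (n ∸ 1)) ℚ.- frac (+ 1) 2) ℚ.* ((ℚ.1ℚ ℚ.- frac (+ 4) n) ^ℚ t))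
mainTheorem7 zero t ()
mainTheorem7 (suc zero) t (ℕ.s≤s ())
mainTheorem7 (suc (suc m)) t _ = expected-length m t , inversion-probability m t
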